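{- For every nonnegative integer $n$, \[ \sum_{j=0}^n (-1)^j \Big( \overline{p} \big(n-6j(9j+7) \big)- \overline{p} \big(n-6j(9j+11)-12 \big) \Big) \geq 0. \]
   Context: An overpartition of $m$ is a partition of $m$ in which the first occurrence of each distinct part may be overlined or not; $\overline{p}(m)$ is the number of overpartitions of $m$, with $\overline{p}(0)=1$ and $\overline{p}(m)=0$ for $m<0$. Equivalently $\sum_{m\ge 0}\overline{p}(m)q^m=\prod_{j\ge1}\frac{1+q^j}{1-q^j}$. -}

module Defs where

open import Data.Nat using (ℕ; zero; suc; _+_; _*_; _∸_; _≤?_)
open import Data.Nat.Properties using ()
open import Data.List using (List; map; upTo; filter)
open import Data.Nat.ListAction using (sum)
open import Data.Integer as ℤ using (ℤ; +_; -[1+_])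
open import Relation.Nullary.Decidable using (does)
open import Data.Bool using (if_then_else_)
open import Data.Nat using (_≡ᵇ_)

-- An overpartition of m is a partition of m in which the first occurrence of
-- each distinct part may be overlined or not.  Equivalently: a choice, for each
-- part size s, of a multiplicity c ≥ 0 with Σ c·s = m, where every size s that
-- occurs (c ≥ 1) comes with 2 choices (first occurrence overlined or not).
--
-- ovUpTo k m = number of overpartitions of m all of whose parts are ≤ k.
-- Recursion on k: choose the multiplicity c of the part size (suc k);
-- c = 0 contributes 1 way, c ≥ 1 contributes 2 ways (overline or not).
weight : ℕ → ℕ
weight zero    = 1
weight (suc _) = 2

ovUpTo : ℕ → ℕ → ℕ
ovUpTo zero    m = if m ≡ᵇ 0 then 1 else 0
ovUpTo (suc k) m =
  sum (map (λ c → weight c * ovUpTo k (m ∸ c * suc k))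
           (filter (λ c → c * suc k ≤? m) (upTo (suc m))))

-- p̄(m): number of overpartitions of m (parts of an overpartition of m are ≤ m).
pbar : ℕ → ℕ
pbar m = ovUpTo m m

pbarℤ : ℤ → ℤ
pbarℤ (+ m)    = + pbar m
pbarℤ -[1+ _ ] = + 0

sign : ℕ → ℤ
sign zero          = + 1
sign (suc zero)    = ℤ.- (+ 1)
sign (suc (suc j)) = sign j

sumTo : ℕ → (ℕ → ℤ) → ℤ
sumTo zero    f = f 0
sumTo (suc n) f = sumTo n f ℤ.+ f (suc n)

-- The sum is the coefficient of qⁿ in P(q) · ∑ⱼ (-1)ʲ (q^(6j(9j+7)) - q^(6j(9j+11)+12)), where
-- P(q) = ∏ₛ (1 + qˢ)/(1 - qˢ) generates p̄. By the Jacobi triple product with modulus q¹⁰⁸ and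
-- z = q⁹⁶, w = q¹², the second factor is ∏ᵢ (1 - q^(108i+12)) (1 - q^(108i+96)) (1 - q^(108i+108)).
-- Each of these factors cancels the denominator of the factor of P(q) with the same exponent, and
-- what remains is a product of series with nonnegative coefficients.
--
-- Only coefficients up to degree n matter, so everything is finite: the triple product comes from
-- the q-binomial theorem for ∏_{i < 2N} (Q^N - z Qⁱ), truncated for N > 2n, and P(q) from the
-- recursion defining ovUpTo.

module Submission where

module PowerSeries where

  open import Algebra.Bundles using (CommutativeRing)
  import Algebra.Solver.Ring.AlmostCommutativeRing as ACR
  open import Data.Integer as ℤ using (ℤ; +_; 0ℤ; 1ℤ)
  import Data.Integer.Properties as ℤ
  open import Data.Integer.Tactic.RingSolver using (solve-∀)
  open import Data.Maybe using (Maybe; just; nothing)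
  open import Data.Nat using (ℕ; zero; suc; _+_; _≤_; _<_; z≤n; s≤s)
  import Data.Nat.Properties as ℕ
  open import Data.Product using (_,_)
  open import Function using (_∘_)
  open import Relation.Binary.PropositionalEquality using (_≡_; refl; sym; trans; cong; cong₂; subst; module ≡-Reasoning)
  import Relation.Binary.Reasoning.Setoid
  open import Relation.Nullary using (yes; no)

  -- Series, _≋_ and NonNegative are records and the operations are defined by copatterns, so that
  -- goals like f ⊕ g ≋ h do not unfold to coefficients and implicit arguments can be inferred.
  record Series : Set where
    no-eta-equality
    field coeff : ℕ → ℤ
  open Series public

  infix 4 _≋_
  record _≋_ (f g : Series) : Set where
    constructor coeffwise
    field coeff-≡ : ∀ n → coeff f n ≡ coeff g n
  open _≋_ public

  const : ℤ → Series
  coeff (const c) zero    = c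
  coeff (const c) (suc _) = 0ℤ

  private
    infix 4 _≐_
    _≐_ : (ℕ → ℤ) → (ℕ → ℤ) → Set
    f ≐ g = ∀ n → f n ≡ g n

    -- The Cauchy product, via f · g = f₀ g + X · ((f - f₀)/X · g).
    cauchy : (ℕ → ℤ) → (ℕ → ℤ) → ℕ → ℤ
    cauchy f g zero    = f 0 ℤ.* g 0
    cauchy f g (suc n) = f 0 ℤ.* g (suc n) ℤ.+ cauchy (f ∘ suc) g n

    cauchy-cong : ∀ {f f′ g g′} → f ≐ f′ → g ≐ g′ → cauchy f g ≐ cauchy f′ g′
    cauchy-cong f≐f′ g≐g′ zero    = cong₂ ℤ._*_ (f≐f′ 0) (g≐g′ 0)
    cauchy-cong f≐f′ g≐g′ (suc n) =
      cong₂ ℤ._+_ (cong₂ ℤ._*_ (f≐f′ 0) (g≐g′ (suc n))) (cauchy-cong (f≐f′ ∘ suc) g≐g′ n)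

    cauchy-constˡ : ∀ c g → cauchy (coeff (const c)) g ≐ λ n → c ℤ.* g n
    cauchy-constˡ c g zero    = refl
    cauchy-constˡ c g (suc n) = trans (cong (ℤ._+_ (c ℤ.* g (suc n))) (zeroˡ g n)) (ℤ.+-identityʳ _)
      where
      zeroˡ : ∀ g → cauchy (λ _ → 0ℤ) g ≐ λ _ → 0ℤ
      zeroˡ g zero    = refl
      zeroˡ g (suc n) = cong (ℤ._+_ 0ℤ) (zeroˡ g n)

    cauchy-distribʳ : ∀ h f g → cauchy (λ n → f n ℤ.+ g n) h ≐ λ n → cauchy f h n ℤ.+ cauchy g h n
    cauchy-distribʳ h f g zero    = ℤ.*-distribʳ-+ (h 0) (f 0) (g 0)
    cauchy-distribʳ h f g (suc n) rewrite cauchy-distribʳ h (f ∘ suc) (g ∘ suc) n =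
      shuffle (f 0) (g 0) (h (suc n)) (cauchy (f ∘ suc) h n) (cauchy (g ∘ suc) h n)
      where
      shuffle : ∀ a b c x y → (a ℤ.+ b) ℤ.* c ℤ.+ (x ℤ.+ y) ≡ (a ℤ.* c ℤ.+ x) ℤ.+ (b ℤ.* c ℤ.+ y)
      shuffle = solve-∀

    cauchy-distribˡ : ∀ f g h → cauchy f (λ n → g n ℤ.+ h n) ≐ λ n → cauchy f g n ℤ.+ cauchy f h n
    cauchy-distribˡ f g h zero    = ℤ.*-distribˡ-+ (f 0) (g 0) (h 0)
    cauchy-distribˡ f g h (suc n) rewrite cauchy-distribˡ (f ∘ suc) g h n =
      shuffle (f 0) (g (suc n)) (h (suc n)) (cauchy (f ∘ suc) g n) (cauchy (f ∘ suc) h n)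
      where
      shuffle : ∀ a b c x y → a ℤ.* (b ℤ.+ c) ℤ.+ (x ℤ.+ y) ≡ (a ℤ.* b ℤ.+ x) ℤ.+ (a ℤ.* c ℤ.+ y)
      shuffle = solve-∀

    cauchy-suc : ∀ f g n → cauchy f g (suc n) ≡ f (suc n) ℤ.* g 0 ℤ.+ cauchy f (g ∘ suc) n
    cauchy-suc f g zero    = ℤ.+-comm (f 0 ℤ.* g 1) (f 1 ℤ.* g 0)
    cauchy-suc f g (suc n) rewrite cauchy-suc (f ∘ suc) g n =
      shuffle (f 0 ℤ.* g (2 + n)) (f (2 + n) ℤ.* g 0) (cauchy (f ∘ suc) (g ∘ suc) n)
      where
      shuffle : ∀ a b x → a ℤ.+ (b ℤ.+ x) ≡ b ℤ.+ (a ℤ.+ x)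
      shuffle = solve-∀

    cauchy-comm : ∀ f g → cauchy f g ≐ cauchy g f
    cauchy-comm f g zero    = ℤ.*-comm (f 0) (g 0)
    cauchy-comm f g (suc n) =
      trans (cong₂ ℤ._+_ (ℤ.*-comm (f 0) (g (suc n))) (cauchy-comm (f ∘ suc) g n)) (sym (cauchy-suc g f n))

    cauchy-scaleˡ : ∀ c g h → cauchy (λ n → c ℤ.* g n) h ≐ λ n → c ℤ.* cauchy g h n
    cauchy-scaleˡ c g h zero    = ℤ.*-assoc c (g 0) (h 0)
    cauchy-scaleˡ c g h (suc n) =
      trans (cong₂ ℤ._+_ (ℤ.*-assoc c (g 0) (h (suc n))) (cauchy-scaleˡ c (g ∘ suc) h n))
            (sym (ℤ.*-distribˡ-+ c (g 0 ℤ.* h (suc n)) (cauchy (g ∘ suc) h n)))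

    cauchy-assoc : ∀ f g h → cauchy (cauchy f g) h ≐ cauchy f (cauchy g h)
    cauchy-assoc f g h zero    = ℤ.*-assoc (f 0) (g 0) (h 0)
    cauchy-assoc f g h (suc n) = begin
      f₀g₀ ℤ.* h (suc n) ℤ.+ cauchy (λ m → f₀ ℤ.* g (suc m) ℤ.+ cauchy (f ∘ suc) g m) h n
        ≡⟨ cong (ℤ._+_ (f₀g₀ ℤ.* h (suc n))) (cauchy-distribʳ h _ (cauchy (f ∘ suc) g) n) ⟩
      f₀g₀ ℤ.* h (suc n) ℤ.+ (cauchy (λ m → f₀ ℤ.* g (suc m)) h n ℤ.+ cauchy (cauchy (f ∘ suc) g) h n)
        ≡⟨ cong (ℤ._+_ (f₀g₀ ℤ.* h (suc n)))
                (cong₂ ℤ._+_ (cauchy-scaleˡ f₀ (g ∘ suc) h n) (cauchy-assoc (f ∘ suc) g h n)) ⟩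
      f₀g₀ ℤ.* h (suc n) ℤ.+ (f₀ ℤ.* cauchy (g ∘ suc) h n ℤ.+ cauchy (f ∘ suc) (cauchy g h) n)
        ≡⟨ shuffle f₀ (g 0) (h (suc n)) (cauchy (g ∘ suc) h n) (cauchy (f ∘ suc) (cauchy g h) n) ⟩
      f₀ ℤ.* (g 0 ℤ.* h (suc n) ℤ.+ cauchy (g ∘ suc) h n) ℤ.+ cauchy (f ∘ suc) (cauchy g h) n ∎
      where
      open ≡-Reasoning
      f₀ = f 0
      f₀g₀ = f₀ ℤ.* g 0
      shuffle : ∀ a b c x y → (a ℤ.* b) ℤ.* c ℤ.+ (a ℤ.* x ℤ.+ y) ≡ a ℤ.* (b ℤ.* c ℤ.+ x) ℤ.+ y
      shuffle = solve-∀

  0ₛ 1ₛ : Series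
  coeff 0ₛ _ = 0ℤ
  1ₛ = const 1ℤ

  infixl 6 _⊕_
  infixl 7 _⊛_
  infix  8 ⊝_

  _⊕_ : Series → Series → Series
  coeff (f ⊕ g) n = coeff f n ℤ.+ coeff g n

  ⊝_ : Series → Series
  coeff (⊝ f) n = ℤ.- coeff f n

  _⊛_ : Series → Series → Series
  coeff (f ⊛ g) = cauchy (coeff f) (coeff g)

  private
    cauchy-local : ∀ m {f f′ g g′} → (∀ {i} → i ≤ m → f i ≡ f′ i) → (∀ {i} → i ≤ m → g i ≡ g′ i) →
                   cauchy f g m ≡ cauchy f′ g′ m
    cauchy-local zero    f≡f′ g≡g′ = cong₂ ℤ._*_ (f≡f′ z≤n) (g≡g′ z≤n)
    cauchy-local (suc m) f≡f′ g≡g′ =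
      cong₂ ℤ._+_ (cong₂ ℤ._*_ (f≡f′ z≤n) (g≡g′ ℕ.≤-refl))
                  (cauchy-local m (f≡f′ ∘ s≤s) (g≡g′ ∘ ℕ.m≤n⇒m≤1+n))

  ⊛-local : ∀ m {f f′ g g′} → (∀ {i} → i ≤ m → coeff f i ≡ coeff f′ i) → (∀ {i} → i ≤ m → coeff g i ≡ coeff g′ i) →
            coeff (f ⊛ g) m ≡ coeff (f′ ⊛ g′) m
  ⊛-local m = cauchy-local m

  ⊛-cong : ∀ {f f′ g g′} → f ≋ f′ → g ≋ g′ → f ⊛ g ≋ f′ ⊛ g′
  ⊛-cong f≋f′ g≋g′ = coeffwise (cauchy-cong (coeff-≡ f≋f′) (coeff-≡ g≋g′))

  const-⊛ : ∀ c g n → coeff (const c ⊛ g) n ≡ c ℤ.* coeff g n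
  const-⊛ c g = cauchy-constˡ c (coeff g)

  ⊛-identityˡ : ∀ g → 1ₛ ⊛ g ≋ g
  ⊛-identityˡ g = coeffwise λ n → trans (const-⊛ 1ℤ g n) (ℤ.*-identityˡ (coeff g n))

  ⊛-comm : ∀ f g → f ⊛ g ≋ g ⊛ f
  ⊛-comm f g = coeffwise (cauchy-comm (coeff f) (coeff g))

  ⊛-assoc : ∀ f g h → (f ⊛ g) ⊛ h ≋ f ⊛ (g ⊛ h)
  ⊛-assoc f g h = coeffwise (cauchy-assoc (coeff f) (coeff g) (coeff h))

  seriesRing : CommutativeRing _ _
  seriesRing = record
    { Carrier = Series ; _≈_ = _≋_ ; _+_ = _⊕_ ; _*_ = _⊛_ ; -_ = ⊝_ ; 0# = 0ₛ ; 1# = 1ₛ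
    ; isCommutativeRing = record
      { isRing = record
        { +-isAbelianGroup = record
          { isGroup = record
            { isMonoid = record
              { isSemigroup = record
                { isMagma = record
                  { isEquivalence = record
                    { refl  = coeffwise λ _ → refl
                    ; sym   = λ p → coeffwise λ n → sym (coeff-≡ p n)
                    ; trans = λ p q → coeffwise λ n → trans (coeff-≡ p n) (coeff-≡ q n) }
                  ; ∙-cong = λ p q → coeffwise λ n → cong₂ ℤ._+_ (coeff-≡ p n) (coeff-≡ q n) }
                ; assoc = λ f g h → coeffwise λ n → ℤ.+-assoc (coeff f n) (coeff g n) (coeff h n) }
              ; identity = (λ f → coeffwise λ n → ℤ.+-identityˡ (coeff f n))
                         , (λ f → coeffwise λ n → ℤ.+-identityʳ (coeff f n)) }
            ; inverse = (λ f → coeffwise λ n → ℤ.+-inverseˡ (coeff f n))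
                      , (λ f → coeffwise λ n → ℤ.+-inverseʳ (coeff f n))
            ; ⁻¹-cong = λ p → coeffwise λ n → cong ℤ.-_ (coeff-≡ p n) }
          ; comm = λ f g → coeffwise λ n → ℤ.+-comm (coeff f n) (coeff g n) }
        ; *-cong = ⊛-cong
        ; *-assoc = ⊛-assoc
        ; *-identity = ⊛-identityˡ , λ g → coeffwise λ n → trans (cauchy-comm (coeff g) (coeff 1ₛ) n) (coeff-≡ (⊛-identityˡ g) n)
        ; distrib = (λ f g h → coeffwise (cauchy-distribˡ (coeff f) (coeff g) (coeff h)))
                  , (λ h f g → coeffwise (cauchy-distribʳ (coeff h) (coeff f) (coeff g))) }
      ; *-comm = ⊛-comm } }

  open CommutativeRing seriesRing public
    using (setoid; +-assoc; +-comm; +-cong; +-congˡ; +-congʳ; *-congˡ; *-congʳ; -‿cong)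
    renaming ( refl to ≋-refl; sym to ≋-sym; trans to ≋-trans
             ; +-identityˡ to ⊕-identityˡ; +-identityʳ to ⊕-identityʳ
             ; *-identityʳ to ⊛-identityʳ; zeroˡ to ⊛-zeroˡ; zeroʳ to ⊛-zeroʳ
             ; distribˡ to ⊛-distribˡ; distribʳ to ⊛-distribʳ
             ; semiring to seriesSemiring; commutativeSemiring to seriesCommutativeSemiring)

  module ≋-Reasoning = Relation.Binary.Reasoning.Setoid setoid

  open import Algebra.Properties.Semiring.Exp seriesSemiring public
    using (_^_; ^-congˡ; ^-homo-*; ^-assocʳ)
  open import Algebra.Properties.CommutativeSemiring.Exp seriesCommutativeSemiring public
    using (^-distrib-*)

  private
    const-homomorphism : ℤ.+-*-rawRing ACR.-Raw-AlmostCommutative⟶ ACR.fromCommutativeRing seriesRing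
    const-homomorphism = record
      { ⟦_⟧    = const
      ; +-homo = λ _ _ → coeffwise λ { zero → refl ; (suc _) → refl }
      ; *-homo = λ a b → coeffwise λ { zero → refl ; (suc n) → sym (trans (const-⊛ a (const b) (suc n)) (ℤ.*-zeroʳ a)) }
      ; -‿homo = λ _ → coeffwise λ { zero → refl ; (suc _) → refl }
      ; 0-homo = coeffwise λ { zero → refl ; (suc _) → refl }
      ; 1-homo = ≋-refl }

    const-≟ : ∀ a b → Maybe (const a ≋ const b)
    const-≟ a b with a ℤ.≟ b
    ... | yes refl = just ≋-refl
    ... | no _     = nothing

  open import Algebra.Solver.Ring ℤ.+-*-rawRing (ACR.fromCommutativeRing seriesRing) const-homomorphism const-≟
    public using (solve; _:=_; _:+_; _:*_; :-_; con)

  ≡⇒≋ : ∀ {f g} → f ≡ g → f ≋ g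
  ≡⇒≋ refl = ≋-refl

  shift : Series → Series
  coeff (shift f) zero    = 0ℤ
  coeff (shift f) (suc n) = coeff f n

  X : Series
  X = shift 1ₛ

  shift-cong : ∀ {f g} → f ≋ g → shift f ≋ shift g
  shift-cong f≋g = coeffwise λ { zero → refl ; (suc n) → coeff-≡ f≋g n }

  shift-⊛ : ∀ f g → shift f ⊛ g ≋ shift (f ⊛ g)
  shift-⊛ f g = coeffwise λ
    { zero    → ℤ.*-zeroˡ (coeff g 0)
    ; (suc n) → trans (cong (ℤ._+ cauchy (coeff f) (coeff g) n) (ℤ.*-zeroˡ (coeff g (suc n)))) (ℤ.+-identityˡ _) }

  X-⊛ : ∀ f → X ⊛ f ≋ shift f
  X-⊛ f = ≋-trans (shift-⊛ 1ₛ f) (shift-cong (⊛-identityˡ f))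

  shiftBy : ℕ → Series → Series
  shiftBy zero    f = f
  shiftBy (suc a) f = shift (shiftBy a f)

  X^-⊛ : ∀ a f → X ^ a ⊛ f ≋ shiftBy a f
  X^-⊛ zero    f = ⊛-identityˡ f
  X^-⊛ (suc a) f = ≋-trans (⊛-assoc X (X ^ a) f) (≋-trans (X-⊛ (X ^ a ⊛ f)) (shift-cong (X^-⊛ a f)))

  1-X^-⊛ : ∀ a f → (1ₛ ⊕ ⊝ X ^ a) ⊛ f ≋ f ⊕ ⊝ shiftBy a f
  1-X^-⊛ a f = ≋-trans (solve 2 (λ x f → (con 1ℤ :+ :- x) :* f := f :+ :- (x :* f)) ≋-refl (X ^ a) f) (+-congˡ (-‿cong (X^-⊛ a f)))

  1+X^-⊛ : ∀ a f → (1ₛ ⊕ X ^ a) ⊛ f ≋ f ⊕ shiftBy a f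
  1+X^-⊛ a f = ≋-trans (solve 2 (λ x f → (con 1ℤ :+ x) :* f := f :+ x :* f) ≋-refl (X ^ a) f) (+-congˡ (X^-⊛ a f))

  shiftBy-+ : ∀ a m f → coeff (shiftBy a f) (a + m) ≡ coeff f m
  shiftBy-+ zero    m f = refl
  shiftBy-+ (suc a) m f = shiftBy-+ a m f

  shiftBy-< : ∀ {a m} f → m < a → coeff (shiftBy a f) m ≡ 0ℤ
  shiftBy-< {suc a} {zero}  f _         = refl
  shiftBy-< {suc a} {suc m} f (s≤s m<a) = shiftBy-< f m<a

  Cancellable : Series → Set
  Cancellable u = ∀ {f g} → u ⊛ f ≋ u ⊛ g → f ≋ g

  ⊛-cancellable : ∀ {u v} → Cancellable u → Cancellable v → Cancellable (u ⊛ v)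
  ⊛-cancellable {u} {v} u-canc v-canc {f} {g} eq =
    v-canc (u-canc (≋-trans (≋-sym (⊛-assoc u v f)) (≋-trans eq (⊛-assoc u v g))))

  ^-cancellable : ∀ {u} → Cancellable u → ∀ k → Cancellable (u ^ k)
  ^-cancellable u-canc zero    eq = ≋-trans (≋-sym (⊛-identityˡ _)) (≋-trans eq (⊛-identityˡ _))
  ^-cancellable u-canc (suc k) = ⊛-cancellable u-canc (^-cancellable u-canc k)

  ⊝-cancellable : ∀ {u} → Cancellable u → Cancellable (⊝ u)
  ⊝-cancellable {u} u-canc {f} {g} eq = u-canc (begin
    u ⊛ f        ≈⟨ solve 2 (λ u f → u :* f := :- (:- u :* f)) ≋-refl u f ⟩
    ⊝ (⊝ u ⊛ f)  ≈⟨ -‿cong eq ⟩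
    ⊝ (⊝ u ⊛ g)  ≈⟨ solve 2 (λ u g → :- (:- u :* g) := u :* g) ≋-refl u g ⟩
    u ⊛ g        ∎)
    where open ≋-Reasoning

  X-cancellable : Cancellable X
  X-cancellable {f} {g} eq = coeffwise λ m → begin
    coeff f m              ≡⟨ coeff-≡ (X-⊛ f) (suc m) ⟨
    coeff (X ⊛ f) (suc m)  ≡⟨ coeff-≡ eq (suc m) ⟩
    coeff (X ⊛ g) (suc m)  ≡⟨ coeff-≡ (X-⊛ g) (suc m) ⟩
    coeff g m              ∎
    where open ≡-Reasoning

  record NonNegative (f : Series) : Set where
    constructor coeffwise-≥0
    field coeff-≥0 : ∀ n → 0ℤ ℤ.≤ coeff f n
  open NonNegative public

  nonNegative-≋ : ∀ {f g} → f ≋ g → NonNegative f → NonNegative g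
  nonNegative-≋ f≋g f≥0 = coeffwise-≥0 λ n → subst (0ℤ ℤ.≤_) (coeff-≡ f≋g n) (coeff-≥0 f≥0 n)

  ⊕-nonNegative : ∀ {f g} → NonNegative f → NonNegative g → NonNegative (f ⊕ g)
  ⊕-nonNegative f≥0 g≥0 = coeffwise-≥0 λ n → ℤ.+-mono-≤ (coeff-≥0 f≥0 n) (coeff-≥0 g≥0 n)

  private
    *-nonNegative : ∀ {i j} → 0ℤ ℤ.≤ i → 0ℤ ℤ.≤ j → 0ℤ ℤ.≤ i ℤ.* j
    *-nonNegative {+ m} {+ n} _ _ = subst (0ℤ ℤ.≤_) (ℤ.pos-* m n) (ℤ.+≤+ z≤n)

    cauchy-nonNegative : ∀ {f g} → (∀ n → 0ℤ ℤ.≤ f n) → (∀ n → 0ℤ ℤ.≤ g n) → ∀ n → 0ℤ ℤ.≤ cauchy f g n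
    cauchy-nonNegative f≥0 g≥0 zero    = *-nonNegative (f≥0 0) (g≥0 0)
    cauchy-nonNegative f≥0 g≥0 (suc n) =
      ℤ.+-mono-≤ (*-nonNegative (f≥0 0) (g≥0 (suc n))) (cauchy-nonNegative (f≥0 ∘ suc) g≥0 n)

  ⊛-nonNegative : ∀ {f g} → NonNegative f → NonNegative g → NonNegative (f ⊛ g)
  ⊛-nonNegative f≥0 g≥0 = coeffwise-≥0 (cauchy-nonNegative (coeff-≥0 f≥0) (coeff-≥0 g≥0))

  1ₛ-nonNegative : NonNegative 1ₛ
  1ₛ-nonNegative = coeffwise-≥0 λ { zero → ℤ.+≤+ z≤n ; (suc n) → ℤ.+≤+ z≤n }

  X^-nonNegative : ∀ a → NonNegative (X ^ a)
  X^-nonNegative a =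
    nonNegative-≋ (≋-trans (≋-sym (X^-⊛ a 1ₛ)) (⊛-identityʳ (X ^ a))) (coeffwise-≥0 (shiftBy-nonNegative a))
    where
    shiftBy-nonNegative : ∀ a n → 0ℤ ℤ.≤ coeff (shiftBy a 1ₛ) n
    shiftBy-nonNegative zero            = coeff-≥0 1ₛ-nonNegative
    shiftBy-nonNegative (suc a) zero    = ℤ.+≤+ z≤n
    shiftBy-nonNegative (suc a) (suc n) = shiftBy-nonNegative a n

module BigOperators where

  open import Data.Nat using (ℕ; zero; suc; _+_)
  import Data.Nat.Properties as ℕ
  open import Function using (_∘_)
  open import Relation.Binary.PropositionalEquality using (_≡_; refl; cong; trans)
  open PowerSeries

  ∏ : ℕ → (ℕ → Series) → Series
  ∏ zero    f = 1ₛ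
  ∏ (suc n) f = ∏ n f ⊛ f n

  syntax ∏ n (λ i → f) = ∏[ i < n ] f

  -- ∑[ i ≤ n ] f i has n + 1 terms, like sumTo.
  ∑ : ℕ → (ℕ → Series) → Series
  ∑ zero    f = f 0
  ∑ (suc n) f = ∑ n f ⊕ f (suc n)

  syntax ∑ n (λ i → f) = ∑[ i ≤ n ] f

  antidiagonalSum : ℕ → (ℕ → ℕ → Series) → Series
  antidiagonalSum zero    g = g 0 0
  antidiagonalSum (suc M) g = g 0 (suc M) ⊕ antidiagonalSum M (λ a b → g (suc a) b)

  syntax antidiagonalSum M (λ a b → g) = ∑[ a + b ≡ M ] g

  -- The terms of ∑[ a + b ≡ M ] g with b ≥ 1.
  antidiagonalSum⁺ : ℕ → (ℕ → ℕ → Series) → Series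
  antidiagonalSum⁺ zero    g = 0ₛ
  antidiagonalSum⁺ (suc M) g = ∑[ a + b ≡ M ] g a (suc b)

  syntax antidiagonalSum⁺ M (λ a b → g) = ∑[ a + b ≡ M ]⁺ g

  ∏-cong : ∀ n {f g} → (∀ i → f i ≋ g i) → ∏ n f ≋ ∏ n g
  ∏-cong zero    f≋g = ≋-refl
  ∏-cong (suc n) f≋g = ⊛-cong (∏-cong n f≋g) (f≋g n)

  ∏-suc : ∀ n f → ∏ (suc n) f ≋ f 0 ⊛ ∏ n (f ∘ suc)
  ∏-suc zero    f = ≋-trans (⊛-identityˡ (f 0)) (≋-sym (⊛-identityʳ (f 0)))
  ∏-suc (suc n) f = ≋-trans (*-congʳ (∏-suc n f)) (⊛-assoc (f 0) _ _)

  ∏-+ : ∀ m n f → ∏ (m + n) f ≋ ∏ m f ⊛ ∏[ i < n ] f (m + i)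
  ∏-+ m zero    f rewrite ℕ.+-identityʳ m = ≋-sym (⊛-identityʳ (∏ m f))
  ∏-+ m (suc n) f rewrite ℕ.+-suc m n =
    ≋-trans (*-congʳ (∏-+ m n f)) (⊛-assoc (∏ m f) _ _)

  ∏-⊛ : ∀ n f g → ∏[ i < n ] (f i ⊛ g i) ≋ ∏ n f ⊛ ∏ n g
  ∏-⊛ zero    f g = ≋-sym (⊛-identityˡ 1ₛ)
  ∏-⊛ (suc n) f g = ≋-trans (*-congʳ (∏-⊛ n f g))
    (solve 4 (λ a b c d → (a :* b) :* (c :* d) := (a :* c) :* (b :* d)) ≋-refl (∏ n f) (∏ n g) (f n) (g n))

  ∏-const : ∀ n c → ∏[ i < n ] c ≋ c ^ n
  ∏-const zero    c = ≋-refl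
  ∏-const (suc n) c = ≋-trans (*-congʳ (∏-const n c)) (⊛-comm (c ^ n) c)

  ∏-nonNegative : ∀ n {f} → (∀ i → NonNegative (f i)) → NonNegative (∏ n f)
  ∏-nonNegative zero    f≥0 = 1ₛ-nonNegative
  ∏-nonNegative (suc n) f≥0 = ⊛-nonNegative (∏-nonNegative n f≥0) (f≥0 n)

  ∑-cong : ∀ n {f g} → (∀ i → f i ≋ g i) → ∑ n f ≋ ∑ n g
  ∑-cong zero    f≋g = f≋g 0
  ∑-cong (suc n) f≋g = +-cong (∑-cong n f≋g) (f≋g (suc n))

  ∑-suc : ∀ n f → ∑ (suc n) f ≋ f 0 ⊕ ∑ n (f ∘ suc)
  ∑-suc zero    f = ≋-refl
  ∑-suc (suc n) f = ≋-trans (+-congʳ (∑-suc n f)) (+-assoc (f 0) _ _)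

  ∑-⊕ : ∀ n f g → ∑[ i ≤ n ] (f i ⊕ g i) ≋ ∑ n f ⊕ ∑ n g
  ∑-⊕ zero    f g = ≋-refl
  ∑-⊕ (suc n) f g = ≋-trans (+-congʳ (∑-⊕ n f g))
    (solve 4 (λ a b c d → (a :+ b) :+ (c :+ d) := (a :+ c) :+ (b :+ d)) ≋-refl (∑ n f) (∑ n g) (f (suc n)) (g (suc n)))

  antidiagonalSum-cong : ∀ M {g h} → (∀ a b → a + b ≡ M → g a b ≋ h a b) →
                         antidiagonalSum M g ≋ antidiagonalSum M h
  antidiagonalSum-cong zero    g≋h = g≋h 0 0 refl
  antidiagonalSum-cong (suc M) g≋h =
    +-cong (g≋h 0 (suc M) refl) (antidiagonalSum-cong M λ a b e → g≋h (suc a) b (cong suc e))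

  antidiagonalSum⁺-cong : ∀ M {g h} → (∀ a b → a + b ≡ M → g a b ≋ h a b) →
                          antidiagonalSum⁺ M g ≋ antidiagonalSum⁺ M h
  antidiagonalSum⁺-cong zero    g≋h = ≋-refl
  antidiagonalSum⁺-cong (suc M) g≋h =
    antidiagonalSum-cong M λ a b e → g≋h a (suc b) (trans (ℕ.+-suc a b) (cong suc e))

  antidiagonalSum-⊕ : ∀ M g h → ∑[ a + b ≡ M ] (g a b ⊕ h a b) ≋ antidiagonalSum M g ⊕ antidiagonalSum M h
  antidiagonalSum-⊕ zero    g h = ≋-refl
  antidiagonalSum-⊕ (suc M) g h = ≋-trans (+-congˡ (antidiagonalSum-⊕ M _ _))
    (solve 4 (λ a b c d → (a :+ b) :+ (c :+ d) := (a :+ c) :+ (b :+ d)) ≋-refl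
       (g 0 (suc M)) (h 0 (suc M)) (antidiagonalSum M (g ∘ suc)) (antidiagonalSum M (h ∘ suc)))

  ⊛-antidiagonalSum : ∀ M c g → c ⊛ antidiagonalSum M g ≋ ∑[ a + b ≡ M ] (c ⊛ g a b)
  ⊛-antidiagonalSum zero    c g = ≋-refl
  ⊛-antidiagonalSum (suc M) c g = ≋-trans (⊛-distribˡ c _ _) (+-congˡ (⊛-antidiagonalSum M c _))

  ⊛-antidiagonalSum⁺ : ∀ M c g → c ⊛ antidiagonalSum⁺ M g ≋ ∑[ a + b ≡ M ]⁺ (c ⊛ g a b)
  ⊛-antidiagonalSum⁺ zero    c g = ⊛-zeroʳ c
  ⊛-antidiagonalSum⁺ (suc M) c g = ⊛-antidiagonalSum M c _

  antidiagonalSum-last : ∀ M g → antidiagonalSum (suc M) g ≋ ∑[ a + b ≡ M ] g a (suc b) ⊕ g (suc M) 0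
  antidiagonalSum-last zero    g = ≋-refl
  antidiagonalSum-last (suc M) g =
    ≋-trans (+-congˡ (antidiagonalSum-last M (g ∘ suc))) (≋-sym (+-assoc (g 0 (suc (suc M))) _ _))

  antidiagonalSum-ignoreʳ : ∀ M f → ∑[ a + b ≡ M ] f a ≋ ∑ M f
  antidiagonalSum-ignoreʳ zero    f = ≋-refl
  antidiagonalSum-ignoreʳ (suc M) f =
    ≋-trans (+-congˡ (antidiagonalSum-ignoreʳ M (f ∘ suc))) (≋-sym (∑-suc M f))

  antidiagonalSum-ignoreˡ : ∀ M f → ∑[ a + b ≡ M ] f b ≋ ∑ M f
  antidiagonalSum-ignoreˡ zero    f = ≋-refl
  antidiagonalSum-ignoreˡ (suc M) f = begin
    antidiagonalSum (suc M) (λ _ b → f b)        ≈⟨ antidiagonalSum-last M (λ _ b → f b) ⟩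
    antidiagonalSum M (λ _ b → f (suc b)) ⊕ f 0  ≈⟨ +-congʳ (antidiagonalSum-ignoreˡ M (f ∘ suc)) ⟩
    ∑ M (f ∘ suc) ⊕ f 0                          ≈⟨ +-comm (∑ M (f ∘ suc)) (f 0) ⟩
    f 0 ⊕ ∑ M (f ∘ suc)                          ≈⟨ ∑-suc M f ⟨
    ∑ (suc M) f                                  ∎
    where open ≋-Reasoning

  antidiagonalSum-+ : ∀ p q g → antidiagonalSum (p + q) g ≋
    ∑[ a + b ≡ p ]⁺ g a (q + b) ⊕ ∑[ k + b ≡ q ] g (p + k) b
  antidiagonalSum-+ zero          q g = ≋-sym (⊕-identityˡ _)
  antidiagonalSum-+ (suc zero)    q g = +-congʳ (≡⇒≋ (cong (g 0) (ℕ.+-comm 1 q)))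
  antidiagonalSum-+ (suc (suc p)) q g =
    ≋-trans (+-cong (≡⇒≋ (cong (g 0) index)) (antidiagonalSum-+ (suc p) q (g ∘ suc)))
            (≋-sym (+-assoc _ _ _))
    where
    index : suc (suc p + q) ≡ q + suc (suc p)
    index = ℕ.+-comm (suc (suc p)) q

module Truncation where

  open import Data.Integer as ℤ using (1ℤ)
  open import Data.Nat using (ℕ; zero; suc; _+_; _*_; _≤_; _<_; s≤s)
  import Data.Nat.Properties as ℕ
  open import Relation.Binary.Bundles using (Setoid)
  import Relation.Binary.Reasoning.Setoid
  open import Relation.Binary.PropositionalEquality using (_≡_; refl; sym; trans; cong; cong₂)
  open PowerSeries
  open BigOperators

  infix 4 _≈[_]_
  record _≈[_]_ (f : Series) (n : ℕ) (g : Series) : Set where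
    constructor agreeUpTo
    field coeff-≡-≤ : ∀ {m} → m ≤ n → coeff f m ≡ coeff g m
  open _≈[_]_ public

  ≈[]-setoid : ℕ → Setoid _ _
  ≈[]-setoid n = record
    { Carrier = Series
    ; _≈_ = _≈[ n ]_
    ; isEquivalence = record
      { refl  = agreeUpTo λ _ → refl
      ; sym   = λ p → agreeUpTo λ m≤n → sym (coeff-≡-≤ p m≤n)
      ; trans = λ p q → agreeUpTo λ m≤n → trans (coeff-≡-≤ p m≤n) (coeff-≡-≤ q m≤n) } }

  module _ {n : ℕ} where
    open Setoid (≈[]-setoid n) public
      using () renaming (refl to ≈[]-refl; sym to ≈[]-sym; trans to ≈[]-trans)

  module ≈[]-Reasoning (n : ℕ) = Relation.Binary.Reasoning.Setoid (≈[]-setoid n)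

  ≋⇒≈[] : ∀ {f g n} → f ≋ g → f ≈[ n ] g
  ≋⇒≈[] f≋g = agreeUpTo λ {m} _ → coeff-≡ f≋g m

  ⊕-≈[] : ∀ {f f′ g g′ n} → f ≈[ n ] f′ → g ≈[ n ] g′ → f ⊕ g ≈[ n ] f′ ⊕ g′
  ⊕-≈[] p q = agreeUpTo λ m≤n → cong₂ ℤ._+_ (coeff-≡-≤ p m≤n) (coeff-≡-≤ q m≤n)

  ⊝-≈[] : ∀ {f g n} → f ≈[ n ] g → ⊝ f ≈[ n ] ⊝ g
  ⊝-≈[] p = agreeUpTo λ m≤n → cong ℤ.-_ (coeff-≡-≤ p m≤n)

  ⊛-≈[] : ∀ {f f′ g g′ n} → f ≈[ n ] f′ → g ≈[ n ] g′ → f ⊛ g ≈[ n ] f′ ⊛ g′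
  ⊛-≈[] {f} {f′} {g} {g′} p q = agreeUpTo λ {m} m≤n →
    ⊛-local m {f} {f′} {g} {g′} (λ i≤m → coeff-≡-≤ p (ℕ.≤-trans i≤m m≤n)) (λ i≤m → coeff-≡-≤ q (ℕ.≤-trans i≤m m≤n))

  X^-⊛-≈[]0 : ∀ {n e} f → n < e → X ^ e ⊛ f ≈[ n ] 0ₛ
  X^-⊛-≈[]0 {e = e} f n<e = agreeUpTo λ {m} m≤n →
    trans (coeff-≡ (X^-⊛ e f) m) (shiftBy-< f (ℕ.≤-<-trans m≤n n<e))

  1-X^-≈[]1 : ∀ {n e} → n < e → 1ₛ ⊕ ⊝ X ^ e ≈[ n ] 1ₛ
  1-X^-≈[]1 {n} {e} n<e = begin
    1ₛ ⊕ ⊝ X ^ e         ≈⟨ ≋⇒≈[] (+-congˡ (-‿cong (≋-sym (⊛-identityʳ (X ^ e))))) ⟩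
    1ₛ ⊕ ⊝ (X ^ e ⊛ 1ₛ)  ≈⟨ ⊕-≈[] ≈[]-refl (⊝-≈[] (X^-⊛-≈[]0 1ₛ n<e)) ⟩
    1ₛ ⊕ ⊝ 0ₛ            ≈⟨ ≋⇒≈[] (≋-trans (+-congˡ (coeffwise λ _ → refl)) (⊕-identityʳ 1ₛ)) ⟩
    1ₛ                   ∎
    where open ≈[]-Reasoning n

  ∏-≈[]1 : ∀ k {n f} → (∀ i → f i ≈[ n ] 1ₛ) → ∏ k f ≈[ n ] 1ₛ
  ∏-≈[]1 zero    f≈1 = ≈[]-refl
  ∏-≈[]1 (suc k) f≈1 = ≈[]-trans (⊛-≈[] (∏-≈[]1 k f≈1) (f≈1 k)) (≋⇒≈[] (⊛-identityˡ 1ₛ))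

  antidiagonalSum-≈[] : ∀ M {n g h} → (∀ a b → a + b ≡ M → g a b ≈[ n ] h a b) →
                        antidiagonalSum M g ≈[ n ] antidiagonalSum M h
  antidiagonalSum-≈[] zero    g≈h = g≈h 0 0 refl
  antidiagonalSum-≈[] (suc M) g≈h =
    ⊕-≈[] (g≈h 0 (suc M) refl) (antidiagonalSum-≈[] M λ a b e → g≈h (suc a) b (cong suc e))

  antidiagonalSum⁺-≈[] : ∀ M {n g h} → (∀ a b → a + b ≡ M → g a b ≈[ n ] h a b) →
                         antidiagonalSum⁺ M g ≈[ n ] antidiagonalSum⁺ M h
  antidiagonalSum⁺-≈[] zero    g≈h = ≈[]-refl
  antidiagonalSum⁺-≈[] (suc M) g≈h =
    antidiagonalSum-≈[] M λ a b e → g≈h a (suc b) (trans (ℕ.+-suc a b) (cong suc e))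

  ∑-truncate : ∀ {n M} f → n ≤ M → (∀ i → n < i → f i ≈[ n ] 0ₛ) → ∑ M f ≈[ n ] ∑ n f
  ∑-truncate {n} f n≤M f≈0 rewrite sym (ℕ.m+[n∸m]≡n n≤M) = extend _
    where
    extend : ∀ d → ∑ (n + d) f ≈[ n ] ∑ n f
    extend zero    rewrite ℕ.+-identityʳ n = ≈[]-refl
    extend (suc d) rewrite ℕ.+-suc n d =
      ≈[]-trans (⊕-≈[] (extend d) (f≈0 (suc (n + d)) (s≤s (ℕ.m≤m+n n d)))) (≋⇒≈[] (⊕-identityʳ (∑ n f)))

  ⊝X^-^-⊛-≈[]0 : ∀ {n k} c f → n < k → (⊝ (X ^ suc c)) ^ k ⊛ f ≈[ n ] 0ₛ
  ⊝X^-^-⊛-≈[]0 {n} {k} c f n<k = begin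
    (⊝ (X ^ suc c)) ^ k ⊛ f              ≈⟨ ≋⇒≈[] (*-congʳ (^-congˡ k (solve 1 (λ x → :- x := :- con 1ℤ :* x) ≋-refl _))) ⟩
    (⊝ 1ₛ ⊛ X ^ suc c) ^ k ⊛ f           ≈⟨ ≋⇒≈[] (*-congʳ (^-distrib-* (⊝ 1ₛ) (X ^ suc c) k)) ⟩
    (⊝ 1ₛ) ^ k ⊛ (X ^ suc c) ^ k ⊛ f     ≈⟨ ≋⇒≈[] (*-congʳ (*-congˡ (^-assocʳ X (suc c) k))) ⟩
    (⊝ 1ₛ) ^ k ⊛ X ^ (suc c * k) ⊛ f     ≈⟨ ≋⇒≈[] (solve 3 (λ s x f → s :* x :* f := x :* (s :* f)) ≋-refl _ _ f) ⟩
    X ^ (suc c * k) ⊛ ((⊝ 1ₛ) ^ k ⊛ f)   ≈⟨ X^-⊛-≈[]0 _ (ℕ.<-≤-trans n<k (ℕ.m≤m+n k (c * k))) ⟩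
    0ₛ                                   ∎
    where open ≈[]-Reasoning n

module TriangularNumbers where

  open import Data.Nat using (ℕ; zero; suc; _+_; _*_)
  import Data.Nat.Properties as ℕ
  open import Data.Nat.Tactic.RingSolver using (solve-∀)
  open import Relation.Binary.PropositionalEquality using (_≡_; refl; cong; sym; module ≡-Reasoning)

  -- triangular a = a (a - 1) / 2
  triangular : ℕ → ℕ
  triangular zero    = 0
  triangular (suc a) = triangular a + a

  triangular-+ : ∀ a b → triangular (a + b) ≡ triangular a + triangular b + a * b
  triangular-+ zero    b = sym (ℕ.+-identityʳ (triangular b))
  triangular-+ (suc a) b = begin
    triangular (a + b) + (a + b)                   ≡⟨ cong (_+ (a + b)) (triangular-+ a b) ⟩
    triangular a + triangular b + a * b + (a + b)  ≡⟨ shuffle (triangular a) (triangular b) a b ⟩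
    triangular a + a + triangular b + suc a * b    ∎
    where
    open ≡-Reasoning
    shuffle : ∀ ta tb a b → ta + tb + a * b + (a + b) ≡ ta + a + tb + (b + a * b)
    shuffle = solve-∀

  triangular-double : ∀ a → triangular a + triangular a + a ≡ a * a
  triangular-double zero    = refl
  triangular-double (suc a) = begin
    triangular a + a + (triangular a + a) + suc a  ≡⟨ shuffle (triangular a) a ⟩
    triangular a + triangular a + a + (a + suc a)  ≡⟨ cong (_+ (a + suc a)) (triangular-double a) ⟩
    a * a + (a + suc a)                            ≡⟨ square a ⟩
    suc a * suc a                                  ∎
    where
    open ≡-Reasoning
    shuffle : ∀ t a → t + a + (t + a) + suc a ≡ t + t + a + (a + suc a)
    shuffle = solve-∀
    square : ∀ a → a * a + (a + suc a) ≡ suc a * suc a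
    square = solve-∀

  upperExponent : ∀ {N} k m → k + m ≡ N → triangular (N + k) + N * m ≡ triangular N + N * N + triangular k
  upperExponent k m refl rewrite triangular-+ (k + m) k = shuffle (triangular (k + m)) (triangular k) k m
    where
    shuffle : ∀ tN tk k m → tN + tk + (k + m) * k + (k + m) * m ≡ tN + (k + m) * (k + m) + tk
    shuffle = solve-∀

  lowerExponent : ∀ {N} a b → a + b ≡ N → triangular a + N * (N + b) ≡ triangular N + N * N + (triangular b + b)
  lowerExponent a b refl = begin
    ta + (a + b) * (a + b + b)                        ≡⟨ expand ta a b ⟩
    ta + (a + b) * (a + b) + a * b + b * b            ≡⟨ cong (ta + (a + b) * (a + b) + a * b +_) (triangular-double b) ⟨
    ta + (a + b) * (a + b) + a * b + (tb + tb + b)    ≡⟨ shuffle ta tb a b ⟩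
    ta + tb + a * b + (a + b) * (a + b) + (tb + b)    ≡⟨ cong (λ t → t + (a + b) * (a + b) + (tb + b)) (triangular-+ a b) ⟨
    triangular (a + b) + (a + b) * (a + b) + (tb + b) ∎
    where
    open ≡-Reasoning
    ta = triangular a
    tb = triangular b
    expand : ∀ ta a b → ta + (a + b) * (a + b + b) ≡ ta + (a + b) * (a + b) + a * b + b * b
    expand = solve-∀
    shuffle : ∀ ta tb a b → ta + (a + b) * (a + b) + a * b + (tb + tb + b) ≡ ta + tb + a * b + (a + b) * (a + b) + (tb + b)
    shuffle = solve-∀

module GaussianBinomial (Q : PowerSeries.Series) where

  open import Data.Integer using (1ℤ)
  open import Data.Nat using (ℕ; zero; suc; _+_)
  open PowerSeries
  open BigOperators
  open TriangularNumbers
  open ≋-Reasoning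

  -- binomial a b is the Gaussian binomial coefficient [a + b choose a] in the variable Q.
  binomial : ℕ → ℕ → Series
  binomial zero    b       = 1ₛ
  binomial (suc a) zero    = 1ₛ
  binomial (suc a) (suc b) = Q ^ suc a ⊛ binomial (suc a) b ⊕ binomial a (suc b)

  -- Q^(a+1) [a + b choose a + 1], which vanishes for b = 0.
  pascalTerm : ℕ → ℕ → Series
  pascalTerm a zero    = 0ₛ
  pascalTerm a (suc b) = Q ^ suc a ⊛ binomial (suc a) b

  binomial-pascal : ∀ a b → binomial (suc a) b ≋ binomial a b ⊕ pascalTerm a b
  binomial-pascal zero    zero    = ≋-sym (⊕-identityʳ 1ₛ)
  binomial-pascal (suc a) zero    = ≋-sym (⊕-identityʳ 1ₛ)
  binomial-pascal a       (suc b) = +-comm _ _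

  -- The (a, b) term of the q-binomial theorem for ∏[ i < a + b ] (y + x Qⁱ).
  qBinomialTerm : Series → Series → ℕ → ℕ → Series
  qBinomialTerm x y a b = Q ^ triangular a ⊛ binomial a b ⊛ x ^ a ⊛ y ^ b

  qBinomialTerm-⊛Q : ∀ x y a b → qBinomialTerm (x ⊛ Q) y a b ≋ Q ^ a ⊛ qBinomialTerm x y a b
  qBinomialTerm-⊛Q x y a b = begin
    Q ^ triangular a ⊛ binomial a b ⊛ (x ⊛ Q) ^ a ⊛ y ^ b
      ≈⟨ *-congʳ (*-congˡ (^-distrib-* x Q a)) ⟩
    Q ^ triangular a ⊛ binomial a b ⊛ (x ^ a ⊛ Q ^ a) ⊛ y ^ b
      ≈⟨ solve 5 (λ t B xa qa yb → t :* B :* (xa :* qa) :* yb := qa :* (t :* B :* xa :* yb)) ≋-refl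
           (Q ^ triangular a) (binomial a b) (x ^ a) (Q ^ a) (y ^ b) ⟩
    Q ^ a ⊛ qBinomialTerm x y a b ∎

  x-⊛-qBinomialTerm : ∀ x y a b → x ⊛ (Q ^ a ⊛ qBinomialTerm x y a b) ≋
                      Q ^ triangular (suc a) ⊛ binomial a b ⊛ x ^ suc a ⊛ y ^ b
  x-⊛-qBinomialTerm x y a b = begin
    x ⊛ (Q ^ a ⊛ (Q ^ triangular a ⊛ binomial a b ⊛ x ^ a ⊛ y ^ b))
      ≈⟨ solve 6 (λ x qa t B xa yb → x :* (qa :* (t :* B :* xa :* yb)) := t :* qa :* B :* (x :* xa) :* yb) ≋-refl
           x (Q ^ a) (Q ^ triangular a) (binomial a b) (x ^ a) (y ^ b) ⟩
    Q ^ triangular a ⊛ Q ^ a ⊛ binomial a b ⊛ x ^ suc a ⊛ y ^ b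
      ≈⟨ *-congʳ (*-congʳ (*-congʳ (≋-sym (^-homo-* Q (triangular a) a)))) ⟩
    Q ^ triangular (suc a) ⊛ binomial a b ⊛ x ^ suc a ⊛ y ^ b ∎

  y-⊛-qBinomialTerm : ∀ x y a b → y ⊛ (Q ^ suc a ⊛ qBinomialTerm x y (suc a) b) ≋
                      Q ^ triangular (suc a) ⊛ pascalTerm a (suc b) ⊛ x ^ suc a ⊛ y ^ suc b
  y-⊛-qBinomialTerm x y a b =
    solve 6 (λ y q t B xa yb → y :* (q :* (t :* B :* xa :* yb)) := t :* (q :* B) :* xa :* (y :* yb)) ≋-refl
      y (Q ^ suc a) (Q ^ triangular (suc a)) (binomial (suc a) b) (x ^ suc a) (y ^ b)

  private
    pascalTerm-zero : ∀ x y a → Q ^ triangular (suc a) ⊛ pascalTerm a 0 ⊛ x ^ suc a ⊛ y ^ 0 ≋ 0ₛ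
    pascalTerm-zero x y a = begin
      Q ^ triangular (suc a) ⊛ 0ₛ ⊛ x ^ suc a ⊛ 1ₛ ≈⟨ *-congʳ (*-congʳ (⊛-zeroʳ _)) ⟩
      0ₛ ⊛ x ^ suc a ⊛ 1ₛ                          ≈⟨ *-congʳ (⊛-zeroˡ _) ⟩
      0ₛ ⊛ 1ₛ                                      ≈⟨ ⊛-zeroˡ _ ⟩
      0ₛ                                           ∎

    y-⊛-qBinomialTerm₀ : ∀ x y b → y ⊛ qBinomialTerm x y 0 b ≋ qBinomialTerm x y 0 (suc b)
    y-⊛-qBinomialTerm₀ x y b =
      solve 2 (λ y yb → y :* (con 1ℤ :* con 1ℤ :* con 1ℤ :* yb) := con 1ℤ :* con 1ℤ :* con 1ℤ :* (y :* yb)) ≋-refl y (y ^ b)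

    y-⊛-qBinomialSum : ∀ M x y → y ⊛ ∑[ a + b ≡ M ] qBinomialTerm (x ⊛ Q) y a b ≋
      qBinomialTerm x y 0 (suc M) ⊕ ∑[ a + b ≡ M ] (Q ^ triangular (suc a) ⊛ pascalTerm a b ⊛ x ^ suc a ⊛ y ^ b)
    y-⊛-qBinomialSum zero x y = begin
      y ⊛ qBinomialTerm (x ⊛ Q) y 0 0                                  ≈⟨ y-⊛-qBinomialTerm₀ (x ⊛ Q) y 0 ⟩
      qBinomialTerm x y 0 1                                            ≈⟨ ⊕-identityʳ _ ⟨
      qBinomialTerm x y 0 1 ⊕ 0ₛ                                       ≈⟨ +-congˡ (pascalTerm-zero x y 0) ⟨
      qBinomialTerm x y 0 1 ⊕ Q ^ triangular 1 ⊛ pascalTerm 0 0 ⊛ x ^ 1 ⊛ y ^ 0 ∎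
    y-⊛-qBinomialSum (suc M) x y = begin
      y ⊛ (qBinomialTerm (x ⊛ Q) y 0 (suc M) ⊕ ∑[ a + b ≡ M ] qBinomialTerm (x ⊛ Q) y (suc a) b)
        ≈⟨ ⊛-distribˡ y _ _ ⟩
      y ⊛ qBinomialTerm (x ⊛ Q) y 0 (suc M) ⊕ y ⊛ (∑[ a + b ≡ M ] qBinomialTerm (x ⊛ Q) y (suc a) b)
        ≈⟨ +-cong (y-⊛-qBinomialTerm₀ (x ⊛ Q) y (suc M)) (⊛-antidiagonalSum M y _) ⟩
      qBinomialTerm x y 0 (suc (suc M)) ⊕ ∑[ a + b ≡ M ] (y ⊛ qBinomialTerm (x ⊛ Q) y (suc a) b)
        ≈⟨ +-congˡ (antidiagonalSum-cong M λ a b _ →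
             ≋-trans (*-congˡ (qBinomialTerm-⊛Q x y (suc a) b)) (y-⊛-qBinomialTerm x y a b)) ⟩
      qBinomialTerm x y 0 (suc (suc M)) ⊕ ∑[ a + b ≡ M ] (Q ^ triangular (suc a) ⊛ pascalTerm a (suc b) ⊛ x ^ suc a ⊛ y ^ suc b)
        ≈⟨ +-congˡ (≋-sym (≋-trans (antidiagonalSum-last M P) (≋-trans (+-congˡ (pascalTerm-zero x y (suc M))) (⊕-identityʳ _)))) ⟩
      qBinomialTerm x y 0 (suc (suc M)) ⊕ ∑[ a + b ≡ suc M ] P a b ∎
      where
      P : ℕ → ℕ → Series
      P a b = Q ^ triangular (suc a) ⊛ pascalTerm a b ⊛ x ^ suc a ⊛ y ^ b

    pascal-step : ∀ x y a b →
      Q ^ triangular (suc a) ⊛ pascalTerm a b ⊛ x ^ suc a ⊛ y ^ b ⊕ Q ^ triangular (suc a) ⊛ binomial a b ⊛ x ^ suc a ⊛ y ^ b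
      ≋ qBinomialTerm x y (suc a) b
    pascal-step x y a b = begin
      t ⊛ pascalTerm a b ⊛ xa ⊛ yb ⊕ t ⊛ binomial a b ⊛ xa ⊛ yb
        ≈⟨ solve 5 (λ t p B xa yb → t :* p :* xa :* yb :+ t :* B :* xa :* yb := t :* (B :+ p) :* xa :* yb) ≋-refl
             t (pascalTerm a b) (binomial a b) xa yb ⟩
      t ⊛ (binomial a b ⊕ pascalTerm a b) ⊛ xa ⊛ yb
        ≈⟨ *-congʳ (*-congʳ (*-congˡ (≋-sym (binomial-pascal a b)))) ⟩
      t ⊛ binomial (suc a) b ⊛ xa ⊛ yb ∎
      where
      t = Q ^ triangular (suc a)
      xa = x ^ suc a
      yb = y ^ b

  qBinomialTheorem : ∀ M x y → ∏[ i < M ] (y ⊕ x ⊛ Q ^ i) ≋ ∑[ a + b ≡ M ] qBinomialTerm x y a b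
  qBinomialTheorem zero    x y = solve 0 (con 1ℤ := con 1ℤ :* con 1ℤ :* con 1ℤ :* con 1ℤ) ≋-refl
  qBinomialTheorem (suc M) x y = begin
    ∏[ i < suc M ] (y ⊕ x ⊛ Q ^ i)
      ≈⟨ ∏-suc M _ ⟩
    (y ⊕ x ⊛ 1ₛ) ⊛ ∏[ i < M ] (y ⊕ x ⊛ (Q ⊛ Q ^ i))
      ≈⟨ ⊛-cong (+-congˡ (⊛-identityʳ x)) (∏-cong M λ i → +-congˡ (≋-sym (⊛-assoc x Q (Q ^ i)))) ⟩
    (y ⊕ x) ⊛ ∏[ i < M ] (y ⊕ (x ⊛ Q) ⊛ Q ^ i)
      ≈⟨ *-congˡ (qBinomialTheorem M (x ⊛ Q) y) ⟩
    (y ⊕ x) ⊛ S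
      ≈⟨ ⊛-distribʳ S y x ⟩
    y ⊛ S ⊕ x ⊛ S
      ≈⟨ +-cong (y-⊛-qBinomialSum M x y) (≋-trans (⊛-antidiagonalSum M x _) (antidiagonalSum-cong M λ a b _ →
           ≋-trans (*-congˡ (qBinomialTerm-⊛Q x y a b)) (x-⊛-qBinomialTerm x y a b))) ⟩
    (qBinomialTerm x y 0 (suc M) ⊕ ∑[ a + b ≡ M ] P a b) ⊕ ∑[ a + b ≡ M ] B a b
      ≈⟨ +-assoc _ _ _ ⟩
    qBinomialTerm x y 0 (suc M) ⊕ (∑[ a + b ≡ M ] P a b ⊕ ∑[ a + b ≡ M ] B a b)
      ≈⟨ +-congˡ (≋-sym (antidiagonalSum-⊕ M P B)) ⟩
    qBinomialTerm x y 0 (suc M) ⊕ ∑[ a + b ≡ M ] (P a b ⊕ B a b)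
      ≈⟨ +-congˡ (antidiagonalSum-cong M λ a b _ → pascal-step x y a b) ⟩
    ∑[ a + b ≡ suc M ] qBinomialTerm x y a b ∎
    where
    S = ∑[ a + b ≡ M ] qBinomialTerm (x ⊛ Q) y a b
    P B : ℕ → ℕ → Series
    P a b = Q ^ triangular (suc a) ⊛ pascalTerm a b ⊛ x ^ suc a ⊛ y ^ b
    B a b = Q ^ triangular (suc a) ⊛ binomial a b ⊛ x ^ suc a ⊛ y ^ b

  pochhammer : Series → ℕ → Series
  pochhammer c N = ∏[ i < N ] (1ₛ ⊕ ⊝ (c ⊛ Q ^ i))

  pochhammer-cong : ∀ N {c c′} → c ≋ c′ → pochhammer c N ≋ pochhammer c′ N
  pochhammer-cong N c≋c′ = ∏-cong N λ i → +-congˡ (-‿cong (*-congʳ c≋c′))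

  pochhammer-suc : ∀ c N → pochhammer c (suc N) ≋ (1ₛ ⊕ ⊝ c) ⊛ pochhammer (c ⊛ Q) N
  pochhammer-suc c N = ≋-trans (∏-suc N _)
    (⊛-cong (+-congˡ (-‿cong (⊛-identityʳ c))) (∏-cong N λ i → +-congˡ (-‿cong (≋-sym (⊛-assoc c Q (Q ^ i))))))

  pochhammer-suc-^ : ∀ k N → pochhammer (Q ^ k) (suc N) ≋ (1ₛ ⊕ ⊝ Q ^ k) ⊛ pochhammer (Q ^ suc k) N
  pochhammer-suc-^ k N = ≋-trans (pochhammer-suc (Q ^ k) N) (*-congˡ (pochhammer-cong N (⊛-comm (Q ^ k) Q)))

  binomial-pochhammerʳ : ∀ a b → binomial a b ⊛ pochhammer Q b ≋ pochhammer (Q ^ suc a) b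
  binomial-pochhammerʳ zero    b       = ≋-trans (⊛-identityˡ _) (pochhammer-cong b (≋-sym (⊛-identityʳ Q)))
  binomial-pochhammerʳ (suc a) zero    = ⊛-identityˡ 1ₛ
  binomial-pochhammerʳ (suc a) (suc b) = begin
    (Q ^ suc a ⊛ binomial (suc a) b ⊕ binomial a (suc b)) ⊛ (pochhammer Q b ⊛ (1ₛ ⊕ ⊝ (Q ⊛ Q ^ b)))
      ≈⟨ solve 5 (λ qa B₁ B₂ P qb → (qa :* B₁ :+ B₂) :* (P :* (con 1ℤ :+ :- qb))
                                    := qa :* (B₁ :* P) :* (con 1ℤ :+ :- qb) :+ B₂ :* (P :* (con 1ℤ :+ :- qb))) ≋-refl
           (Q ^ suc a) (binomial (suc a) b) (binomial a (suc b)) (pochhammer Q b) (Q ⊛ Q ^ b) ⟩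
    Q ^ suc a ⊛ (binomial (suc a) b ⊛ pochhammer Q b) ⊛ (1ₛ ⊕ ⊝ (Q ⊛ Q ^ b)) ⊕ binomial a (suc b) ⊛ pochhammer Q (suc b)
      ≈⟨ +-cong (*-congʳ (*-congˡ (binomial-pochhammerʳ (suc a) b))) (binomial-pochhammerʳ a (suc b)) ⟩
    Q ^ suc a ⊛ R ⊛ (1ₛ ⊕ ⊝ (Q ⊛ Q ^ b)) ⊕ pochhammer (Q ^ suc a) (suc b)
      ≈⟨ +-congˡ (pochhammer-suc-^ (suc a) b) ⟩
    Q ^ suc a ⊛ R ⊛ (1ₛ ⊕ ⊝ (Q ⊛ Q ^ b)) ⊕ (1ₛ ⊕ ⊝ Q ^ suc a) ⊛ R
      ≈⟨ solve 4 (λ q qa qb R → qa :* R :* (con 1ℤ :+ :- (q :* qb)) :+ (con 1ℤ :+ :- qa) :* R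
                               := R :* (con 1ℤ :+ :- (q :* qa :* qb))) ≋-refl Q (Q ^ suc a) (Q ^ b) R ⟩
    pochhammer (Q ^ suc (suc a)) (suc b) ∎
    where
    R = pochhammer (Q ^ suc (suc a)) b

  binomial-pochhammerˡ : ∀ a b → binomial a b ⊛ pochhammer Q a ≋ pochhammer (Q ^ suc b) a
  binomial-pochhammerˡ zero    b       = ⊛-identityˡ 1ₛ
  binomial-pochhammerˡ (suc a) zero    = ≋-trans (⊛-identityˡ _) (pochhammer-cong (suc a) (≋-sym (⊛-identityʳ Q)))
  binomial-pochhammerˡ (suc a) (suc b) = begin
    (Q ^ suc a ⊛ binomial (suc a) b ⊕ binomial a (suc b)) ⊛ (pochhammer Q a ⊛ (1ₛ ⊕ ⊝ (Q ⊛ Q ^ a)))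
      ≈⟨ solve 4 (λ qa B₁ B₂ P → (qa :* B₁ :+ B₂) :* (P :* (con 1ℤ :+ :- qa))
                                := qa :* (B₁ :* (P :* (con 1ℤ :+ :- qa))) :+ B₂ :* P :* (con 1ℤ :+ :- qa)) ≋-refl
           (Q ^ suc a) (binomial (suc a) b) (binomial a (suc b)) (pochhammer Q a) ⟩
    Q ^ suc a ⊛ (binomial (suc a) b ⊛ pochhammer Q (suc a)) ⊕ binomial a (suc b) ⊛ pochhammer Q a ⊛ (1ₛ ⊕ ⊝ Q ^ suc a)
      ≈⟨ +-cong (*-congˡ (binomial-pochhammerˡ (suc a) b)) (*-congʳ (binomial-pochhammerˡ a (suc b))) ⟩
    Q ^ suc a ⊛ pochhammer (Q ^ suc b) (suc a) ⊕ R ⊛ (1ₛ ⊕ ⊝ Q ^ suc a)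
      ≈⟨ +-congʳ (*-congˡ (pochhammer-suc-^ (suc b) a)) ⟩
    Q ^ suc a ⊛ ((1ₛ ⊕ ⊝ Q ^ suc b) ⊛ R) ⊕ R ⊛ (1ₛ ⊕ ⊝ Q ^ suc a)
      ≈⟨ solve 4 (λ q qa qb R → q :* qa :* ((con 1ℤ :+ :- qb) :* R) :+ R :* (con 1ℤ :+ :- (q :* qa))
                               := R :* (con 1ℤ :+ :- (q :* qb :* qa))) ≋-refl Q (Q ^ a) (Q ^ suc b) R ⟩
    pochhammer (Q ^ suc (suc b)) (suc a) ∎
    where
    R = pochhammer (Q ^ suc (suc b)) a

open import Data.Nat using (ℕ)
open PowerSeries using (Series; _≋_; _⊛_)

module FiniteTripleProduct (Q z w : Series) (zw≋Q : z ⊛ w ≋ Q) where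

  open import Data.Integer using (1ℤ)
  open import Data.Nat using (ℕ; zero; suc; _+_; _*_)
  open import Relation.Binary.PropositionalEquality using (_≡_; cong)
  open PowerSeries
  open BigOperators
  open TriangularNumbers
  open GaussianBinomial Q
  open ≋-Reasoning

  -- ∑_{-N ≤ k ≤ N} (-z)ᵏ Q^(k(k-1)/2) [2N choose N + k], the terms with k = -b < 0 rewritten using z⁻¹ = w Q⁻¹.
  tripleProductSum : ℕ → Series
  tripleProductSum N = ∑[ k + m ≡ N ] ((⊝ z) ^ k ⊛ Q ^ triangular k ⊛ binomial (N + k) m)
                     ⊕ ∑[ a + b ≡ N ]⁺ ((⊝ w) ^ b ⊛ Q ^ triangular b ⊛ binomial a (N + b))

  private
    Q^-+ : ∀ a b c d e → a + b ≡ c + d + e → Q ^ a ⊛ Q ^ b ≋ Q ^ c ⊛ Q ^ d ⊛ Q ^ e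
    Q^-+ a b c d e eq = begin
      Q ^ a ⊛ Q ^ b          ≈⟨ ^-homo-* Q a b ⟨
      Q ^ (a + b)            ≡⟨ cong (Q ^_) eq ⟩
      Q ^ (c + d + e)        ≈⟨ ^-homo-* Q (c + d) e ⟩
      Q ^ (c + d) ⊛ Q ^ e    ≈⟨ *-congʳ (^-homo-* Q c d) ⟩
      Q ^ c ⊛ Q ^ d ⊛ Q ^ e  ∎

    -- The common factor pulled out of the q-binomial expansion of ∏_{i < 2N} (Q^N - z Qⁱ).
    C : ℕ → Series
    C N = (⊝ z) ^ N ⊛ Q ^ triangular N ⊛ Q ^ (N * N)

    lowerHalfProduct : ∀ N → ∏[ i < N ] (Q ^ N ⊕ ⊝ z ⊛ Q ^ i) ≋ (⊝ z) ^ N ⊛ Q ^ triangular N ⊛ pochhammer w N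
    lowerHalfProduct zero    = ≋-sym (≋-trans (⊛-identityʳ _) (⊛-identityʳ _))
    lowerHalfProduct (suc N) = begin
      ∏[ i < suc N ] (Q ^ suc N ⊕ ⊝ z ⊛ Q ^ i)
        ≈⟨ ∏-suc N _ ⟩
      (Q ⊛ Q ^ N ⊕ ⊝ z ⊛ 1ₛ) ⊛ ∏[ i < N ] (Q ⊛ Q ^ N ⊕ ⊝ z ⊛ (Q ⊛ Q ^ i))
        ≈⟨ *-congˡ (∏-cong N λ i → solve 4 (λ q qN z qi → q :* qN :+ :- z :* (q :* qi) := q :* (qN :+ :- z :* qi))
                                         ≋-refl Q (Q ^ N) z (Q ^ i)) ⟩
      (Q ⊛ Q ^ N ⊕ ⊝ z ⊛ 1ₛ) ⊛ ∏[ i < N ] (Q ⊛ (Q ^ N ⊕ ⊝ z ⊛ Q ^ i))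
        ≈⟨ ⊛-cong (+-congʳ (*-congʳ (≋-sym zw≋Q))) (≋-trans (∏-⊛ N _ _) (⊛-cong (∏-const N Q) (lowerHalfProduct N))) ⟩
      (z ⊛ w ⊛ Q ^ N ⊕ ⊝ z ⊛ 1ₛ) ⊛ (Q ^ N ⊛ ((⊝ z) ^ N ⊛ Q ^ triangular N ⊛ pochhammer w N))
        ≈⟨ solve 6 (λ z w qN zN qt P → (z :* w :* qN :+ :- z :* con 1ℤ) :* (qN :* (zN :* qt :* P))
                                        := (:- z :* zN) :* (qt :* qN) :* (P :* (con 1ℤ :+ :- (w :* qN)))) ≋-refl
             z w (Q ^ N) ((⊝ z) ^ N) (Q ^ triangular N) (pochhammer w N) ⟩
      (⊝ z) ^ suc N ⊛ (Q ^ triangular N ⊛ Q ^ N) ⊛ pochhammer w (suc N)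
        ≈⟨ *-congʳ (*-congˡ (≋-sym (^-homo-* Q (triangular N) N))) ⟩
      (⊝ z) ^ suc N ⊛ Q ^ triangular (suc N) ⊛ pochhammer w (suc N) ∎

    doubledProduct : ∀ N → ∏[ i < N + N ] (Q ^ N ⊕ ⊝ z ⊛ Q ^ i) ≋ C N ⊛ (pochhammer z N ⊛ pochhammer w N)
    doubledProduct N = begin
      ∏[ i < N + N ] (Q ^ N ⊕ ⊝ z ⊛ Q ^ i)
        ≈⟨ ∏-+ N N _ ⟩
      ∏[ i < N ] (Q ^ N ⊕ ⊝ z ⊛ Q ^ i) ⊛ ∏[ i < N ] (Q ^ N ⊕ ⊝ z ⊛ Q ^ (N + i))
        ≈⟨ ⊛-cong (lowerHalfProduct N) (∏-cong N λ i → ≋-trans (+-congˡ (*-congˡ (^-homo-* Q N i)))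
             (solve 3 (λ qN z qi → qN :+ :- z :* (qN :* qi) := qN :* (con 1ℤ :+ :- (z :* qi))) ≋-refl (Q ^ N) z (Q ^ i))) ⟩
      (⊝ z) ^ N ⊛ Q ^ triangular N ⊛ pochhammer w N ⊛ ∏[ i < N ] (Q ^ N ⊛ (1ₛ ⊕ ⊝ (z ⊛ Q ^ i)))
        ≈⟨ *-congˡ (≋-trans (∏-⊛ N _ _) (*-congʳ (≋-trans (∏-const N (Q ^ N)) (^-assocʳ Q N N)))) ⟩
      (⊝ z) ^ N ⊛ Q ^ triangular N ⊛ pochhammer w N ⊛ (Q ^ (N * N) ⊛ pochhammer z N)
        ≈⟨ solve 5 (λ zN qt W qNN Z → zN :* qt :* W :* (qNN :* Z) := zN :* qt :* qNN :* (Z :* W)) ≋-refl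
             ((⊝ z) ^ N) (Q ^ triangular N) (pochhammer w N) (Q ^ (N * N)) (pochhammer z N) ⟩
      C N ⊛ (pochhammer z N ⊛ pochhammer w N) ∎

    upperTerm : ∀ N k m → k + m ≡ N →
      qBinomialTerm (⊝ z) (Q ^ N) (N + k) m ≋ C N ⊛ ((⊝ z) ^ k ⊛ Q ^ triangular k ⊛ binomial (N + k) m)
    upperTerm N k m k+m≡N = begin
      Q ^ triangular (N + k) ⊛ B ⊛ (⊝ z) ^ (N + k) ⊛ (Q ^ N) ^ m
        ≈⟨ ⊛-cong (*-congˡ (^-homo-* (⊝ z) N k)) (^-assocʳ Q N m) ⟩
      Q ^ triangular (N + k) ⊛ B ⊛ ((⊝ z) ^ N ⊛ (⊝ z) ^ k) ⊛ Q ^ (N * m)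
        ≈⟨ solve 5 (λ t B zN zk q → t :* B :* (zN :* zk) :* q := (t :* q) :* (zN :* zk :* B)) ≋-refl
             (Q ^ triangular (N + k)) B ((⊝ z) ^ N) ((⊝ z) ^ k) (Q ^ (N * m)) ⟩
      (Q ^ triangular (N + k) ⊛ Q ^ (N * m)) ⊛ ((⊝ z) ^ N ⊛ (⊝ z) ^ k ⊛ B)
        ≈⟨ *-congʳ (Q^-+ _ (N * m) (triangular N) (N * N) (triangular k) (upperExponent k m k+m≡N)) ⟩
      (Q ^ triangular N ⊛ Q ^ (N * N) ⊛ Q ^ triangular k) ⊛ ((⊝ z) ^ N ⊛ (⊝ z) ^ k ⊛ B)
        ≈⟨ solve 6 (λ tN NN tk zN zk B → (tN :* NN :* tk) :* (zN :* zk :* B) := zN :* tN :* NN :* (zk :* tk :* B)) ≋-refl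
             (Q ^ triangular N) (Q ^ (N * N)) (Q ^ triangular k) ((⊝ z) ^ N) ((⊝ z) ^ k) B ⟩
      C N ⊛ ((⊝ z) ^ k ⊛ Q ^ triangular k ⊛ B) ∎
      where B = binomial (N + k) m

    lowerTerm : ∀ N a b → a + b ≡ N →
      qBinomialTerm (⊝ z) (Q ^ N) a (N + b) ≋ C N ⊛ ((⊝ w) ^ b ⊛ Q ^ triangular b ⊛ binomial a (N + b))
    lowerTerm N a b a+b≡N = begin
      Q ^ triangular a ⊛ B ⊛ (⊝ z) ^ a ⊛ (Q ^ N) ^ (N + b)
        ≈⟨ *-congˡ (^-assocʳ Q N (N + b)) ⟩
      Q ^ triangular a ⊛ B ⊛ (⊝ z) ^ a ⊛ Q ^ (N * (N + b))
        ≈⟨ solve 4 (λ t B za q → t :* B :* za :* q := (t :* q) :* (za :* B)) ≋-refl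
             (Q ^ triangular a) B ((⊝ z) ^ a) (Q ^ (N * (N + b))) ⟩
      (Q ^ triangular a ⊛ Q ^ (N * (N + b))) ⊛ ((⊝ z) ^ a ⊛ B)
        ≈⟨ *-congʳ (≋-trans (Q^-+ _ (N * (N + b)) (triangular N) (N * N) _ (lowerExponent a b a+b≡N)) (*-congˡ (^-homo-* Q (triangular b) b))) ⟩
      Q ^ triangular N ⊛ Q ^ (N * N) ⊛ (Q ^ triangular b ⊛ Q ^ b) ⊛ ((⊝ z) ^ a ⊛ B)
        ≈⟨ *-congʳ (*-congˡ (*-congˡ (≋-sym Q^b≋))) ⟩
      Q ^ triangular N ⊛ Q ^ (N * N) ⊛ (Q ^ triangular b ⊛ ((⊝ z) ^ b ⊛ (⊝ w) ^ b)) ⊛ ((⊝ z) ^ a ⊛ B)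
        ≈⟨ solve 7 (λ tN NN tb zb wb za B → tN :* NN :* (tb :* (zb :* wb)) :* (za :* B)
                                           := (za :* zb) :* tN :* NN :* (wb :* tb :* B)) ≋-refl
             (Q ^ triangular N) (Q ^ (N * N)) (Q ^ triangular b) ((⊝ z) ^ b) ((⊝ w) ^ b) ((⊝ z) ^ a) B ⟩
      ((⊝ z) ^ a ⊛ (⊝ z) ^ b) ⊛ Q ^ triangular N ⊛ Q ^ (N * N) ⊛ ((⊝ w) ^ b ⊛ Q ^ triangular b ⊛ B)
        ≈⟨ *-congʳ (*-congʳ (*-congʳ (≋-trans (≋-sym (^-homo-* (⊝ z) a b)) (≡⇒≋ (cong ((⊝ z) ^_) a+b≡N))))) ⟩
      C N ⊛ ((⊝ w) ^ b ⊛ Q ^ triangular b ⊛ B) ∎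
      where
      B = binomial a (N + b)
      Q^b≋ : (⊝ z) ^ b ⊛ (⊝ w) ^ b ≋ Q ^ b
      Q^b≋ = ≋-trans (≋-sym (^-distrib-* (⊝ z) (⊝ w) b))
                     (^-congˡ b (≋-trans (solve 2 (λ z w → :- z :* :- w := z :* w) ≋-refl z w) zw≋Q))

    qBinomialSum-split : ∀ N → ∑[ a + b ≡ N + N ] qBinomialTerm (⊝ z) (Q ^ N) a b ≋ C N ⊛ tripleProductSum N
    qBinomialSum-split N = begin
      ∑[ a + b ≡ N + N ] qBinomialTerm (⊝ z) (Q ^ N) a b
        ≈⟨ antidiagonalSum-+ N N _ ⟩
      ∑[ a + b ≡ N ]⁺ qBinomialTerm (⊝ z) (Q ^ N) a (N + b) ⊕ ∑[ k + m ≡ N ] qBinomialTerm (⊝ z) (Q ^ N) (N + k) m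
        ≈⟨ +-cong (antidiagonalSum⁺-cong N (lowerTerm N)) (antidiagonalSum-cong N (upperTerm N)) ⟩
      ∑[ a + b ≡ N ]⁺ (C N ⊛ lower a b) ⊕ ∑[ k + m ≡ N ] (C N ⊛ upper k m)
        ≈⟨ +-cong (≋-sym (⊛-antidiagonalSum⁺ N (C N) lower)) (≋-sym (⊛-antidiagonalSum N (C N) upper)) ⟩
      C N ⊛ antidiagonalSum⁺ N lower ⊕ C N ⊛ antidiagonalSum N upper
        ≈⟨ +-comm _ _ ⟩
      C N ⊛ antidiagonalSum N upper ⊕ C N ⊛ antidiagonalSum⁺ N lower
        ≈⟨ ⊛-distribˡ (C N) _ _ ⟨
      C N ⊛ tripleProductSum N ∎
      where
      upper lower : ℕ → ℕ → Series
      upper k m = (⊝ z) ^ k ⊛ Q ^ triangular k ⊛ binomial (N + k) m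
      lower a b = (⊝ w) ^ b ⊛ Q ^ triangular b ⊛ binomial a (N + b)

  finiteTripleProduct : Cancellable z → Cancellable Q → ∀ N → pochhammer z N ⊛ pochhammer w N ≋ tripleProductSum N
  finiteTripleProduct z-canc Q-canc N = C-cancellable (begin
    C N ⊛ (pochhammer z N ⊛ pochhammer w N)        ≈⟨ doubledProduct N ⟨
    ∏[ i < N + N ] (Q ^ N ⊕ ⊝ z ⊛ Q ^ i)           ≈⟨ qBinomialTheorem (N + N) (⊝ z) (Q ^ N) ⟩
    ∑[ a + b ≡ N + N ] qBinomialTerm (⊝ z) (Q ^ N) a b ≈⟨ qBinomialSum-split N ⟩
    C N ⊛ tripleProductSum N                       ∎)
    where
    C-cancellable : Cancellable (C N)
    C-cancellable = ⊛-cancellable (⊛-cancellable (^-cancellable (⊝-cancellable z-canc) N)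
                                                 (^-cancellable Q-canc (triangular N)))
                                  (^-cancellable Q-canc (N * N))

module TruncatedTripleProduct (c d : ℕ) where

  open import Data.Nat using (ℕ; suc; _+_; _*_; _≤_; _<_; s≤s; _≤?_)
  import Data.Nat.Properties as ℕ
  open import Function using (_∘_)
  open import Relation.Binary.PropositionalEquality using (_≡_; refl; sym; trans)
  open import Relation.Nullary using (yes; no)
  open PowerSeries
  open BigOperators
  open Truncation
  open TriangularNumbers

  z w Q : Series
  z = X ^ suc c
  w = X ^ suc d
  Q = X ^ (suc c + suc d)

  open GaussianBinomial Q
  open FiniteTripleProduct Q z w (≋-sym (^-homo-* X (suc c) (suc d)))

  private
    Q^-≋ : ∀ e → Q ^ e ≋ X ^ (suc (c + suc d) * e)
    Q^-≋ e = ^-assocʳ X (suc c + suc d) e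

    1-Q^-≈[]1 : ∀ {n e} → n < e → 1ₛ ⊕ ⊝ Q ^ e ≈[ n ] 1ₛ
    1-Q^-≈[]1 {n} {e} n<e = ≈[]-trans (≋⇒≈[] (+-congˡ (-‿cong (Q^-≋ e))))
                                      (1-X^-≈[]1 (ℕ.<-≤-trans n<e (ℕ.m≤m+n e ((c + suc d) * e))))

    pochhammer-≈[]1 : ∀ {n k} m → n < k → pochhammer (Q ^ k) m ≈[ n ] 1ₛ
    pochhammer-≈[]1 {k = k} m n<k = ∏-≈[]1 m λ i →
      ≈[]-trans (≋⇒≈[] (+-congˡ (-‿cong (≋-sym (^-homo-* Q k i))))) (1-Q^-≈[]1 (ℕ.<-≤-trans n<k (ℕ.m≤m+n k i)))

    pochhammer-stable : ∀ {n M} m e → n ≤ m → m + e ≡ M → pochhammer Q M ≈[ n ] pochhammer Q m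
    pochhammer-stable m e n≤m refl = ≈[]-trans (≋⇒≈[] (∏-+ m e _))
      (≈[]-trans (⊛-≈[] ≈[]-refl (∏-≈[]1 e λ i → 1-Q^-≈[]1 (s≤s (ℕ.≤-trans n≤m (ℕ.m≤m+n m i)))))
                 (≋⇒≈[] (⊛-identityʳ _)))

  upper lower : ℕ → Series
  upper k = (⊝ z) ^ k ⊛ Q ^ triangular k
  lower b = (⊝ w) ^ b ⊛ Q ^ triangular b

  private
    complement-≥ : ∀ {n N k m} → k ≤ n → n + n < N → k + m ≡ N → n ≤ m
    complement-≥ {n} {N} {k} {m} k≤n n+n<N k+m≡N = ℕ.<⇒≤ (ℕ.+-cancelˡ-< k n m
      (ℕ.≤-<-trans (ℕ.+-monoˡ-≤ n k≤n) (ℕ.<-≤-trans n+n<N (ℕ.≤-reflexive (sym k+m≡N)))))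

    n<N+k : ∀ {n N} k → n + n < N → n < suc (N + k)
    n<N+k {n} {N} k n+n<N = s≤s (ℕ.≤-trans (ℕ.m≤m+n n n) (ℕ.≤-trans (ℕ.<⇒≤ n+n<N) (ℕ.m≤m+n N k)))

    -- For k > n both sides vanish below degree n + 1; for k ≤ n we have m > n, and the binomial
    -- times (Q; Q)_N is (Q^(N+k+1); Q)_m there, which is 1 up to degree n.
    upperTerm-≈[] : ∀ {n N} → n + n < N → ∀ k m → k + m ≡ N →
                    pochhammer Q N ⊛ (upper k ⊛ binomial (N + k) m) ≈[ n ] upper k
    upperTerm-≈[] {n} {N} n+n<N k m k+m≡N with k ≤? n
    ... | no k≰n = ≈[]-trans (≋⇒≈[] (solve 4 (λ P z t B → P :* (z :* t :* B) := z :* (t :* B :* P)) ≋-refl _ _ _ _))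
                     (≈[]-trans (⊝X^-^-⊛-≈[]0 c _ (ℕ.≰⇒> k≰n)) (≈[]-sym (⊝X^-^-⊛-≈[]0 c _ (ℕ.≰⇒> k≰n))))
    ... | yes k≤n = begin
      pochhammer Q N ⊛ (upper k ⊛ binomial (N + k) m)  ≈⟨ ≋⇒≈[] (solve 3 (λ P u B → P :* (u :* B) := u :* (B :* P)) ≋-refl _ _ _) ⟩
      upper k ⊛ (binomial (N + k) m ⊛ pochhammer Q N)  ≈⟨ ⊛-≈[] ≈[]-refl (⊛-≈[] ≈[]-refl
                                                            (pochhammer-stable m k (complement-≥ k≤n n+n<N k+m≡N) (trans (ℕ.+-comm m k) k+m≡N))) ⟩
      upper k ⊛ (binomial (N + k) m ⊛ pochhammer Q m)  ≈⟨ ≋⇒≈[] (*-congˡ (binomial-pochhammerʳ (N + k) m)) ⟩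
      upper k ⊛ pochhammer (Q ^ suc (N + k)) m         ≈⟨ ⊛-≈[] ≈[]-refl (pochhammer-≈[]1 m (n<N+k k n+n<N)) ⟩
      upper k ⊛ 1ₛ                                     ≈⟨ ≋⇒≈[] (⊛-identityʳ _) ⟩
      upper k                                          ∎
      where open ≈[]-Reasoning n

    lowerTerm-≈[] : ∀ {n N} → n + n < N → ∀ a b → a + b ≡ N →
                    pochhammer Q N ⊛ (lower b ⊛ binomial a (N + b)) ≈[ n ] lower b
    lowerTerm-≈[] {n} {N} n+n<N a b a+b≡N with b ≤? n
    ... | no b≰n = ≈[]-trans (≋⇒≈[] (solve 4 (λ P w t B → P :* (w :* t :* B) := w :* (t :* B :* P)) ≋-refl _ _ _ _))
                     (≈[]-trans (⊝X^-^-⊛-≈[]0 d _ (ℕ.≰⇒> b≰n)) (≈[]-sym (⊝X^-^-⊛-≈[]0 d _ (ℕ.≰⇒> b≰n))))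
    ... | yes b≤n = begin
      pochhammer Q N ⊛ (lower b ⊛ binomial a (N + b))  ≈⟨ ≋⇒≈[] (solve 3 (λ P v B → P :* (v :* B) := v :* (B :* P)) ≋-refl _ _ _) ⟩
      lower b ⊛ (binomial a (N + b) ⊛ pochhammer Q N)  ≈⟨ ⊛-≈[] ≈[]-refl (⊛-≈[] ≈[]-refl
                                                            (pochhammer-stable a b (complement-≥ b≤n n+n<N (trans (ℕ.+-comm b a) a+b≡N)) a+b≡N)) ⟩
      lower b ⊛ (binomial a (N + b) ⊛ pochhammer Q a)  ≈⟨ ≋⇒≈[] (*-congˡ (binomial-pochhammerˡ a (N + b))) ⟩
      lower b ⊛ pochhammer (Q ^ suc (N + b)) a         ≈⟨ ⊛-≈[] ≈[]-refl (pochhammer-≈[]1 a (n<N+k b n+n<N)) ⟩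
      lower b ⊛ 1ₛ                                     ≈⟨ ≋⇒≈[] (⊛-identityʳ _) ⟩
      lower b                                          ∎
      where open ≈[]-Reasoning n

  truncatedTripleProduct : ∀ {n N} → n + n < N →
    pochhammer z N ⊛ pochhammer w N ⊛ pochhammer Q N ≈[ n ] ∑[ j ≤ n ] (upper j ⊕ lower (suc j))
  truncatedTripleProduct {n} {suc N′} n+n<N = begin
    pochhammer z N ⊛ pochhammer w N ⊛ P
      ≈⟨ ≋⇒≈[] (≋-trans (⊛-comm _ P) (*-congˡ (finiteTripleProduct (X^-cancellable (suc c)) (X^-cancellable (suc c + suc d)) N))) ⟩
    P ⊛ tripleProductSum N
      ≈⟨ ≋⇒≈[] (≋-trans (⊛-distribˡ P _ _) (+-cong (⊛-antidiagonalSum N P (λ k m → upper k ⊛ binomial (N + k) m))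
                                                   (⊛-antidiagonalSum⁺ N P (λ a b → lower b ⊛ binomial a (N + b))))) ⟩
    ∑[ k + m ≡ N ] (P ⊛ (upper k ⊛ binomial (N + k) m)) ⊕ ∑[ a + b ≡ N ]⁺ (P ⊛ (lower b ⊛ binomial a (N + b)))
      ≈⟨ ⊕-≈[] (antidiagonalSum-≈[] N (upperTerm-≈[] n+n<N)) (antidiagonalSum⁺-≈[] N (lowerTerm-≈[] n+n<N)) ⟩
    ∑[ k + m ≡ N ] upper k ⊕ ∑[ a + b ≡ N ]⁺ lower b
      ≈⟨ ≋⇒≈[] (+-cong (antidiagonalSum-ignoreʳ N upper) (antidiagonalSum-ignoreˡ N′ (lower ∘ suc))) ⟩
    ∑ N upper ⊕ ∑ N′ (lower ∘ suc)
      ≈⟨ ⊕-≈[] (∑-truncate upper (ℕ.≤-trans (ℕ.m≤m+n n n) (ℕ.<⇒≤ n+n<N)) λ i n<i → ⊝X^-^-⊛-≈[]0 c _ n<i)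
               (∑-truncate (lower ∘ suc) (ℕ.≤-trans (ℕ.m≤m+n n n) (ℕ.≤-pred n+n<N)) λ i n<i → ⊝X^-^-⊛-≈[]0 d _ (ℕ.m<n⇒m<1+n n<i)) ⟩
    ∑ n upper ⊕ ∑ n (lower ∘ suc)
      ≈⟨ ≋⇒≈[] (≋-sym (∑-⊕ n upper (lower ∘ suc))) ⟩
    ∑[ j ≤ n ] (upper j ⊕ lower (suc j)) ∎
    where
    N = suc N′
    P = pochhammer Q N
    X^-cancellable : ∀ k → Cancellable (X ^ k)
    X^-cancellable = ^-cancellable X-cancellable
    open ≈[]-Reasoning n

module Overpartitions where

  open import Data.Bool using (true; false; if_then_else_)
  import Data.Integer as ℤ
  import Data.Integer.Properties as ℤ
  open import Data.Integer.Tactic.RingSolver using () renaming (solve-∀ to ℤ-solve-∀)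
  open import Data.List using (List; []; _∷_; map; filter; upTo; applyUpTo)
  open import Data.Nat using (ℕ; zero; suc; _+_; _*_; _∸_; _≤_; _<_; z≤n; s≤s; _≤?_)
  import Data.Nat.Properties as ℕ
  open import Data.Nat.ListAction using (sum)
  open import Data.Nat.Tactic.RingSolver using () renaming (solve-∀ to ℕ-solve-∀)
  open import Data.Nat.Induction using (<-rec)
  open import Function using (_∘_)
  open import Relation.Binary.PropositionalEquality using (_≡_; refl; cong; cong₂; sym; trans; subst; module ≡-Reasoning)
  open import Relation.Nullary using (Dec; yes; no; does; ¬_)
  open import Relation.Nullary.Negation using (contradiction)
  open import Defs using (weight; ovUpTo)
  open PowerSeries
  open BigOperators

  addPart : ℕ → (ℕ → ℕ) → ℕ → ℕ
  addPart s f m = sum (map (λ c → weight c * f (m ∸ c * s)) (filter (λ c → c * s ≤? m) (upTo (suc m))))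

  private
    onlyIf : ∀ {P : Set} → Dec P → ℕ → ℕ
    onlyIf P? x = if does P? then x else 0

    onlyIf-no : ∀ {P : Set} (P? : Dec P) x → ¬ P → onlyIf P? x ≡ 0
    onlyIf-no (yes p) x ¬p = contradiction p ¬p
    onlyIf-no (no _)  x _  = refl

    onlyIf-cong : ∀ {P R : Set} (P? : Dec P) (R? : Dec R) {x y} → (P → R) → (R → P) → x ≡ y → onlyIf P? x ≡ onlyIf R? y
    onlyIf-cong (yes _) (yes _) _   _   x≡y = x≡y
    onlyIf-cong (yes p) (no ¬r) p→r _   _   = contradiction (p→r p) ¬r
    onlyIf-cong (no ¬p) (yes r) _   r→p _   = contradiction (r→p r) ¬p
    onlyIf-cong (no _)  (no _)  _   _   _   = refl

    sum-filter : ∀ {P : ℕ → Set} (P? : ∀ x → Dec (P x)) (F : ℕ → ℕ) xs →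
                 sum (map F (filter P? xs)) ≡ sum (map (λ c → onlyIf (P? c) (F c)) xs)
    sum-filter P? F []       = refl
    sum-filter P? F (x ∷ xs) with does (P? x)
    ... | true  = cong (F x +_) (sum-filter P? F xs)
    ... | false = sum-filter P? F xs

    ∑< : ℕ → (ℕ → ℕ) → ℕ
    ∑< zero    g = 0
    ∑< (suc L) g = g 0 + ∑< L (g ∘ suc)

    sum-applyUpTo : ∀ (g h : ℕ → ℕ) L → sum (map g (applyUpTo h L)) ≡ ∑< L (g ∘ h)
    sum-applyUpTo g h zero    = refl
    sum-applyUpTo g h (suc L) = cong (g (h 0) +_) (sum-applyUpTo g (h ∘ suc) L)

    ∑<-cong : ∀ L {g h} → (∀ c → g c ≡ h c) → ∑< L g ≡ ∑< L h
    ∑<-cong zero    g≡h = refl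
    ∑<-cong (suc L) g≡h = cong₂ _+_ (g≡h 0) (∑<-cong L (g≡h ∘ suc))

    ∑<-zero : ∀ L {g} → (∀ c → g c ≡ 0) → ∑< L g ≡ 0
    ∑<-zero zero    g≡0 = refl
    ∑<-zero (suc L) g≡0 = cong₂ _+_ (g≡0 0) (∑<-zero L (g≡0 ∘ suc))

    ∑<-+ : ∀ L e {g} → (∀ c → L ≤ c → g c ≡ 0) → ∑< (L + e) g ≡ ∑< L g
    ∑<-+ zero    e g≡0 = ∑<-zero e λ c → g≡0 c z≤n
    ∑<-+ (suc L) e g≡0 = cong (_ +_) (∑<-+ L e λ c L≤c → g≡0 (suc c) (s≤s L≤c))

    multiplicityTerm : ℕ → (ℕ → ℕ) → ℕ → ℕ → ℕ
    multiplicityTerm s f m c = onlyIf (c * s ≤? m) (weight c * f (m ∸ c * s))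

    addPart-∑< : ∀ s f m → addPart s f m ≡ f m + ∑< m (multiplicityTerm s f m ∘ suc)
    addPart-∑< s f m = begin
      addPart s f m                                          ≡⟨ sum-filter (λ c → c * s ≤? m) (λ c → weight c * f (m ∸ c * s)) (upTo (suc m)) ⟩
      sum (map (multiplicityTerm s f m) (upTo (suc m)))      ≡⟨ sum-applyUpTo (multiplicityTerm s f m) (λ c → c) (suc m) ⟩
      f m + 0 + ∑< m (multiplicityTerm s f m ∘ suc)          ≡⟨ cong (_+ ∑< m (multiplicityTerm s f m ∘ suc)) (ℕ.+-identityʳ (f m)) ⟩
      f m + ∑< m (multiplicityTerm s f m ∘ suc)              ∎
      where open ≡-Reasoning

  module _ (s′ : ℕ) (f : ℕ → ℕ) where
    private
      s = suc s′

    addPart-< : ∀ {m} → m < s → addPart s f m ≡ f m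
    addPart-< {m} m<s = trans (addPart-∑< s f m)
      (trans (cong (f m +_) (∑<-zero m λ c → onlyIf-no (suc c * s ≤? m) _ (too-big c))) (ℕ.+-identityʳ (f m)))
      where
      too-big : ∀ c → ¬ (suc c * s ≤ m)
      too-big c cs≤m = ℕ.<-irrefl refl (ℕ.<-≤-trans m<s (ℕ.≤-trans (ℕ.m≤m+n s (c * s)) cs≤m))

    -- Multiplying by 1 - X^s: the terms with c ≥ 1 at degree s + m are those with c - 1 at degree m, doubled.
    addPart-+ : ∀ m → addPart s f (s + m) ≡ f (s + m) + (f m + addPart s f m)
    addPart-+ m = begin
      addPart s f (s + m)
        ≡⟨ addPart-∑< s f (s + m) ⟩
      f (s + m) + ∑< (s + m) (multiplicityTerm s f (s + m) ∘ suc)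
        ≡⟨ cong (f (s + m) +_) (∑<-cong (s + m) shifted) ⟩
      f (s + m) + ∑< (s + m) (doubled)
        ≡⟨ cong (λ L → f (s + m) + ∑< (suc L) doubled) (ℕ.+-comm s′ m) ⟩
      f (s + m) + (2 * f m + ∑< (m + s′) (doubled ∘ suc))
        ≡⟨ cong (λ t → f (s + m) + (2 * f m + t)) (∑<-+ m s′ vanish) ⟩
      f (s + m) + (2 * f m + ∑< m (doubled ∘ suc))
        ≡⟨ cong (f (s + m) +_) (regroup (f m) (∑< m (doubled ∘ suc))) ⟩
      f (s + m) + (f m + (f m + ∑< m (multiplicityTerm s f m ∘ suc)))
        ≡⟨ cong (λ t → f (s + m) + (f m + t)) (addPart-∑< s f m) ⟨
      f (s + m) + (f m + addPart s f m) ∎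
      where
      open ≡-Reasoning
      doubled : ℕ → ℕ
      doubled c = onlyIf (c * s ≤? m) (2 * f (m ∸ c * s))
      shifted : ∀ c → multiplicityTerm s f (s + m) (suc c) ≡ doubled c
      shifted c = onlyIf-cong (suc c * s ≤? s + m) (c * s ≤? m) (ℕ.+-cancelˡ-≤ s _ _) (ℕ.+-monoʳ-≤ s)
        (cong (λ t → 2 * f t) (ℕ.[m+n]∸[m+o]≡n∸o s m (c * s)))
      vanish : ∀ c → m ≤ c → doubled (suc c) ≡ 0
      vanish c m≤c = onlyIf-no (suc c * s ≤? m) _
        λ cs≤m → ℕ.<-irrefl refl (ℕ.<-≤-trans (s≤s m≤c) (ℕ.≤-trans (ℕ.m≤m*n (suc c) s) cs≤m))
      regroup : ∀ a b → 2 * a + b ≡ a + (a + b)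
      regroup = ℕ-solve-∀

  ofℕ : (ℕ → ℕ) → Series
  coeff (ofℕ f) n = ℤ.+ f n

  ofℕ-nonNegative : ∀ f → NonNegative (ofℕ f)
  ofℕ-nonNegative f = coeffwise-≥0 λ _ → ℤ.+≤+ z≤n

  1-X^-⊛-addPart : ∀ s′ f → (1ₛ ⊕ ⊝ X ^ suc s′) ⊛ ofℕ (addPart (suc s′) f) ≋ (1ₛ ⊕ X ^ suc s′) ⊛ ofℕ f
  1-X^-⊛-addPart s′ f = ≋-trans (1-X^-⊛ s A) (≋-trans (coeffwise coefficients) (≋-sym (1+X^-⊛ s (ofℕ f))))
    where
    s = suc s′
    A = ofℕ (addPart s f)
    below : ∀ {m} → m < s → coeff (A ⊕ ⊝ shiftBy s A) m ≡ coeff (ofℕ f ⊕ shiftBy s (ofℕ f)) m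
    below {m} m<s = begin
      ℤ.+ addPart s f m ℤ.+ ℤ.- coeff (shiftBy s A) m  ≡⟨ cong₂ (λ a t → ℤ.+ a ℤ.+ ℤ.- t) (addPart-< s′ f m<s) (shiftBy-< A m<s) ⟩
      ℤ.+ f m ℤ.+ ℤ.- ℤ.0ℤ                              ≡⟨ cong (ℤ._+_ (ℤ.+ f m)) (sym (shiftBy-< (ofℕ f) m<s)) ⟩
      ℤ.+ f m ℤ.+ coeff (shiftBy s (ofℕ f)) m          ∎
      where open ≡-Reasoning
    above : ∀ m → coeff (A ⊕ ⊝ shiftBy s A) (s + m) ≡ coeff (ofℕ f ⊕ shiftBy s (ofℕ f)) (s + m)
    above m = begin
      ℤ.+ addPart s f (s + m) ℤ.+ ℤ.- coeff (shiftBy s A) (s + m)   ≡⟨ cong₂ (λ a t → ℤ.+ a ℤ.+ ℤ.- t) (addPart-+ s′ f m) (shiftBy-+ s m A) ⟩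
      ℤ.+ (f (s + m) + (f m + addPart s f m)) ℤ.+ ℤ.- ℤ.+ addPart s f m
        ≡⟨ cong (λ t → t ℤ.+ ℤ.- ℤ.+ addPart s f m) (trans (ℤ.pos-+ (f (s + m)) _) (cong (ℤ._+_ (ℤ.+ f (s + m))) (ℤ.pos-+ (f m) _))) ⟩
      ℤ.+ f (s + m) ℤ.+ (ℤ.+ f m ℤ.+ ℤ.+ addPart s f m) ℤ.+ ℤ.- ℤ.+ addPart s f m
        ≡⟨ cancel (ℤ.+ f (s + m)) (ℤ.+ f m) (ℤ.+ addPart s f m) ⟩
      ℤ.+ f (s + m) ℤ.+ ℤ.+ f m                                     ≡⟨ cong (ℤ._+_ (ℤ.+ f (s + m))) (sym (shiftBy-+ s m (ofℕ f))) ⟩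
      ℤ.+ f (s + m) ℤ.+ coeff (shiftBy s (ofℕ f)) (s + m)           ∎
      where
      open ≡-Reasoning
      cancel : ∀ a b c → a ℤ.+ (b ℤ.+ c) ℤ.+ ℤ.- c ≡ a ℤ.+ b
      cancel = ℤ-solve-∀
    coefficients : ∀ m → coeff (A ⊕ ⊝ shiftBy s A) m ≡ coeff (ofℕ f ⊕ shiftBy s (ofℕ f)) m
    coefficients m with s ≤? m
    ... | no s≰m  = below (ℕ.≰⇒> s≰m)
    ... | yes s≤m = subst (λ m → coeff (A ⊕ ⊝ shiftBy s A) m ≡ coeff (ofℕ f ⊕ shiftBy s (ofℕ f)) m)
                          (ℕ.m+[n∸m]≡n s≤m) (above (m ∸ s))

  1-X^-cancellable : ∀ s′ → Cancellable (1ₛ ⊕ ⊝ X ^ suc s′)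
  1-X^-cancellable s′ {f} {g} eq = coeffwise (<-rec _ step)
    where
    s = suc s′
    -- f m - f (m - s) = g m - g (m - s), so f and g agree by strong induction on m.
    diff : ∀ m → coeff f m ℤ.+ ℤ.- coeff (shiftBy s f) m ≡ coeff g m ℤ.+ ℤ.- coeff (shiftBy s g) m
    diff m = trans (sym (coeff-≡ (1-X^-⊛ s f) m)) (trans (coeff-≡ eq m) (coeff-≡ (1-X^-⊛ s g) m))
    step : ∀ m → (∀ {k} → k < m → coeff f k ≡ coeff g k) → coeff f m ≡ coeff g m
    step m f≡g with s ≤? m
    ... | no s≰m = begin
      coeff f m                                   ≡⟨ ℤ.+-identityʳ (coeff f m) ⟨
      coeff f m ℤ.+ ℤ.- ℤ.0ℤ                      ≡⟨ cong (λ t → coeff f m ℤ.+ ℤ.- t) (shiftBy-< f (ℕ.≰⇒> s≰m)) ⟨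
      coeff f m ℤ.+ ℤ.- coeff (shiftBy s f) m     ≡⟨ diff m ⟩
      coeff g m ℤ.+ ℤ.- coeff (shiftBy s g) m     ≡⟨ cong (λ t → coeff g m ℤ.+ ℤ.- t) (shiftBy-< g (ℕ.≰⇒> s≰m)) ⟩
      coeff g m ℤ.+ ℤ.- ℤ.0ℤ                      ≡⟨ ℤ.+-identityʳ (coeff g m) ⟩
      coeff g m                                   ∎
      where open ≡-Reasoning
    ... | yes s≤m = subst (λ m → coeff f m ≡ coeff g m) (ℕ.m+[n∸m]≡n s≤m) (begin
      coeff f (s + r)                                                   ≡⟨ unshift (coeff f (s + r)) (coeff f r) ⟩
      coeff f (s + r) ℤ.+ ℤ.- coeff f r ℤ.+ coeff f r                   ≡⟨ cong (λ b → coeff f (s + r) ℤ.+ ℤ.- b ℤ.+ coeff f r) (shiftBy-+ s r f) ⟨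
      coeff f (s + r) ℤ.+ ℤ.- coeff (shiftBy s f) (s + r) ℤ.+ coeff f r ≡⟨ cong₂ ℤ._+_ (diff (s + r)) (f≡g r<m) ⟩
      coeff g (s + r) ℤ.+ ℤ.- coeff (shiftBy s g) (s + r) ℤ.+ coeff g r ≡⟨ cong (λ b → coeff g (s + r) ℤ.+ ℤ.- b ℤ.+ coeff g r) (shiftBy-+ s r g) ⟩
      coeff g (s + r) ℤ.+ ℤ.- coeff g r ℤ.+ coeff g r                   ≡⟨ unshift (coeff g (s + r)) (coeff g r) ⟨
      coeff g (s + r)                                                   ∎)
      where
      open ≡-Reasoning
      r = m ∸ s
      r<m : r < m
      r<m = ℕ.∸-monoʳ-< {m} {s} {0} (s≤s z≤n) s≤m
      unshift : ∀ a b → a ≡ a ℤ.+ ℤ.- b ℤ.+ b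
      unshift = ℤ-solve-∀

  -- The generating function (1 + X^s)/(1 - X^s) of overpartitions into parts equal to s.
  partFactor : ℕ → Series
  partFactor s = ofℕ (addPart s (ovUpTo 0))

  private
    ofℕ-ovUpTo₀ : ofℕ (ovUpTo 0) ≋ 1ₛ
    ofℕ-ovUpTo₀ = coeffwise λ { zero → refl ; (suc _) → refl }

  1-X^-⊛-partFactor : ∀ s′ → (1ₛ ⊕ ⊝ X ^ suc s′) ⊛ partFactor (suc s′) ≋ 1ₛ ⊕ X ^ suc s′
  1-X^-⊛-partFactor s′ = ≋-trans (1-X^-⊛-addPart s′ (ovUpTo 0)) (≋-trans (*-congˡ ofℕ-ovUpTo₀) (⊛-identityʳ _))

  ofℕ-ovUpTo-suc : ∀ k → ofℕ (ovUpTo (suc k)) ≋ partFactor (suc k) ⊛ ofℕ (ovUpTo k)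
  ofℕ-ovUpTo-suc k = 1-X^-cancellable k (begin
    (1ₛ ⊕ ⊝ X ^ suc k) ⊛ ofℕ (ovUpTo (suc k))                  ≈⟨ 1-X^-⊛-addPart k (ovUpTo k) ⟩
    (1ₛ ⊕ X ^ suc k) ⊛ ofℕ (ovUpTo k)                          ≈⟨ *-congʳ (1-X^-⊛-partFactor k) ⟨
    (1ₛ ⊕ ⊝ X ^ suc k) ⊛ partFactor (suc k) ⊛ ofℕ (ovUpTo k)   ≈⟨ ⊛-assoc _ _ _ ⟩
    (1ₛ ⊕ ⊝ X ^ suc k) ⊛ (partFactor (suc k) ⊛ ofℕ (ovUpTo k)) ∎)
    where open ≋-Reasoning

  ofℕ-ovUpTo : ∀ K → ofℕ (ovUpTo K) ≋ ∏[ i < K ] partFactor (suc i)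
  ofℕ-ovUpTo zero    = ofℕ-ovUpTo₀
  ofℕ-ovUpTo (suc K) = ≋-trans (ofℕ-ovUpTo-suc K) (≋-trans (*-congˡ (ofℕ-ovUpTo K)) (⊛-comm _ _))

  ovUpTo-stable : ∀ {m k} → m ≤ k → ovUpTo k m ≡ ovUpTo m m
  ovUpTo-stable {m} {k} m≤k = subst (λ k → ovUpTo k m ≡ ovUpTo m m) (ℕ.m+[n∸m]≡n m≤k) (go (k ∸ m))
    where
    go : ∀ d → ovUpTo (m + d) m ≡ ovUpTo m m
    go zero    = cong (λ k → ovUpTo k m) (ℕ.+-identityʳ m)
    go (suc d) = trans (cong (λ k → ovUpTo k m) (ℕ.+-suc m d))
                       (trans (addPart-< (m + d) (ovUpTo (m + d)) (s≤s (ℕ.m≤m+n m d))) (go d))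

  -- The factors 1 - X^e for a strictly increasing sequence b < e₁ < e₂ < ⋯, encoded by its gaps eᵢ₊₁ - eᵢ - 1.
  removedFactors : ℕ → List ℕ → Series
  removedFactors b []       = 1ₛ
  removedFactors b (d ∷ ds) = (1ₛ ⊕ ⊝ X ^ suc (d + b)) ⊛ removedFactors (suc (d + b)) ds

  span : List ℕ → ℕ
  span []       = 0
  span (d ∷ ds) = suc d + span ds

  partFactors : ℕ → ℕ → Series
  partFactors b ℓ = ∏[ i < ℓ ] partFactor (suc (b + i))

  -- Each 1 - X^e turns the factor (1 + X^e)/(1 - X^e) of partFactors into 1 + X^e.
  partFactors-⊛-removedFactors-nonNegative : ∀ b ds → NonNegative (partFactors b (span ds) ⊛ removedFactors b ds)
  partFactors-⊛-removedFactors-nonNegative b []       = ⊛-nonNegative 1ₛ-nonNegative 1ₛ-nonNegative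
  partFactors-⊛-removedFactors-nonNegative b (d ∷ ds) =
    nonNegative-≋ (≋-sym regroup)
      (⊛-nonNegative (⊛-nonNegative (∏-nonNegative d λ _ → ofℕ-nonNegative _) (⊕-nonNegative 1ₛ-nonNegative (X^-nonNegative e)))
                     (partFactors-⊛-removedFactors-nonNegative e ds))
    where
    e = suc (d + b)
    index : ∀ i → b + (suc d + i) ≡ e + i
    index = λ i → shuffle b d i
      where
      shuffle : ∀ b d i → b + (suc d + i) ≡ suc (d + b) + i
      shuffle = ℕ-solve-∀
    regroup : partFactors b (suc d + span ds) ⊛ ((1ₛ ⊕ ⊝ X ^ e) ⊛ removedFactors e ds) ≋
              partFactors b d ⊛ (1ₛ ⊕ X ^ e) ⊛ (partFactors e (span ds) ⊛ removedFactors e ds)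
    regroup = begin
      partFactors b (suc d + span ds) ⊛ ((1ₛ ⊕ ⊝ X ^ e) ⊛ removedFactors e ds)
        ≈⟨ *-congʳ (∏-+ (suc d) (span ds) _) ⟩
      partFactors b d ⊛ partFactor (suc (b + d)) ⊛ ∏[ i < span ds ] partFactor (suc (b + (suc d + i)))
        ⊛ ((1ₛ ⊕ ⊝ X ^ e) ⊛ removedFactors e ds)
        ≈⟨ *-congʳ (⊛-cong (*-congˡ (≡⇒≋ (cong (partFactor ∘ suc) (ℕ.+-comm b d))))
                           (∏-cong (span ds) λ i → ≡⇒≋ (cong (partFactor ∘ suc) (index i)))) ⟩
      partFactors b d ⊛ partFactor e ⊛ partFactors e (span ds) ⊛ ((1ₛ ⊕ ⊝ X ^ e) ⊛ removedFactors e ds)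
        ≈⟨ solve 5 (λ P W P′ D R → P :* W :* P′ :* (D :* R) := P :* (D :* W) :* (P′ :* R)) ≋-refl
             (partFactors b d) (partFactor e) (partFactors e (span ds)) (1ₛ ⊕ ⊝ X ^ e) (removedFactors e ds) ⟩
      partFactors b d ⊛ ((1ₛ ⊕ ⊝ X ^ e) ⊛ partFactor e) ⊛ (partFactors e (span ds) ⊛ removedFactors e ds)
        ≈⟨ *-congʳ (*-congˡ (1-X^-⊛-partFactor (d + b))) ⟩
      partFactors b d ⊛ (1ₛ ⊕ X ^ e) ⊛ (partFactors e (span ds) ⊛ removedFactors e ds) ∎
      where open ≋-Reasoning

module Modulus108 where

  import Data.Integer as ℤ
  import Data.Integer.Properties as ℤ
  open import Data.Integer.Tactic.RingSolver using () renaming (solve-∀ to ℤ-solve-∀)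
  open import Data.List using (List; []; _∷_)
  open import Data.Nat using (ℕ; zero; suc; _+_; _*_; _≤_; _<_; _≤?_; _∸_)
  import Data.Nat.Properties as ℕ
  open import Data.Nat.Tactic.RingSolver using () renaming (solve-∀ to ℕ-solve-∀)
  open import Relation.Binary.PropositionalEquality using (_≡_; refl; cong; cong₂; sym; trans; subst; module ≡-Reasoning)
  open import Relation.Nullary using (Dec; yes; no)
  open import Defs using (ovUpTo; pbarℤ; sign; sumTo)
  open PowerSeries
  open BigOperators
  open Truncation
  open TriangularNumbers
  open Overpartitions
  open TruncatedTripleProduct 95 11
  open GaussianBinomial Q using (pochhammer)

  a b : ℕ → ℕ
  a j = 6 * j * (9 * j + 7)
  b j = 6 * j * (9 * j + 11) + 12

  Θ : ℕ → Series
  Θ n = ∑[ j ≤ n ] ((⊝ 1ₛ) ^ j ⊛ (X ^ a j ⊕ ⊝ X ^ b j))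

  private
    ⊝X^-^-⊛-X^-^ : ∀ p q j t → (⊝ (X ^ p)) ^ j ⊛ (X ^ q) ^ t ≋ (⊝ 1ₛ) ^ j ⊛ X ^ (p * j + q * t)
    ⊝X^-^-⊛-X^-^ p q j t = begin
      (⊝ (X ^ p)) ^ j ⊛ (X ^ q) ^ t            ≈⟨ *-congʳ (^-congˡ j (solve 1 (λ x → :- x := :- con ℤ.1ℤ :* x) ≋-refl (X ^ p))) ⟩
      (⊝ 1ₛ ⊛ X ^ p) ^ j ⊛ (X ^ q) ^ t         ≈⟨ *-congʳ (^-distrib-* (⊝ 1ₛ) (X ^ p) j) ⟩
      (⊝ 1ₛ) ^ j ⊛ (X ^ p) ^ j ⊛ (X ^ q) ^ t   ≈⟨ ⊛-cong (*-congˡ (^-assocʳ X p j)) (^-assocʳ X q t) ⟩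
      (⊝ 1ₛ) ^ j ⊛ X ^ (p * j) ⊛ X ^ (q * t)   ≈⟨ ⊛-assoc _ _ _ ⟩
      (⊝ 1ₛ) ^ j ⊛ (X ^ (p * j) ⊛ X ^ (q * t)) ≈⟨ *-congˡ (^-homo-* X (p * j) (q * t)) ⟨
      (⊝ 1ₛ) ^ j ⊛ X ^ (p * j + q * t)         ∎
      where open ≋-Reasoning

    a-exponent : ∀ j → 96 * j + 108 * triangular j ≡ a j
    a-exponent j = begin
      96 * j + 108 * t             ≡⟨ regroup j t ⟩
      54 * (t + t + j) + 42 * j    ≡⟨ cong (λ s → 54 * s + 42 * j) (triangular-double j) ⟩
      54 * (j * j) + 42 * j        ≡⟨ factor j ⟩
      a j                          ∎
      where
      open ≡-Reasoning
      t = triangular j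
      regroup : ∀ j t → 96 * j + 108 * t ≡ 54 * (t + t + j) + 42 * j
      regroup = ℕ-solve-∀
      factor : ∀ j → 54 * (j * j) + 42 * j ≡ 6 * j * (9 * j + 7)
      factor = ℕ-solve-∀

    b-exponent : ∀ j → 12 * suc j + 108 * triangular (suc j) ≡ b j
    b-exponent j = begin
      12 * suc j + 108 * (t + j)         ≡⟨ regroup j t ⟩
      54 * (t + t + j) + 66 * j + 12     ≡⟨ cong (λ s → 54 * s + 66 * j + 12) (triangular-double j) ⟩
      54 * (j * j) + 66 * j + 12         ≡⟨ factor j ⟩
      b j                                ∎
      where
      open ≡-Reasoning
      t = triangular j
      regroup : ∀ j t → 12 * suc j + 108 * (t + j) ≡ 54 * (t + t + j) + 66 * j + 12
      regroup = ℕ-solve-∀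
      factor : ∀ j → 54 * (j * j) + 66 * j + 12 ≡ 6 * j * (9 * j + 11) + 12
      factor = ℕ-solve-∀

    tripleProductTerm : ∀ j → upper j ⊕ lower (suc j) ≋ (⊝ 1ₛ) ^ j ⊛ (X ^ a j ⊕ ⊝ X ^ b j)
    tripleProductTerm j = begin
      upper j ⊕ lower (suc j)
        ≈⟨ +-cong (⊝X^-^-⊛-X^-^ 96 108 j (triangular j)) (⊝X^-^-⊛-X^-^ 12 108 (suc j) (triangular (suc j))) ⟩
      (⊝ 1ₛ) ^ j ⊛ X ^ (96 * j + 108 * triangular j) ⊕ ⊝ 1ₛ ⊛ (⊝ 1ₛ) ^ j ⊛ X ^ (12 * suc j + 108 * triangular (suc j))
        ≈⟨ +-cong (*-congˡ (≡⇒≋ (cong (X ^_) (a-exponent j)))) (*-congˡ (≡⇒≋ (cong (X ^_) (b-exponent j)))) ⟩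
      (⊝ 1ₛ) ^ j ⊛ X ^ a j ⊕ ⊝ 1ₛ ⊛ (⊝ 1ₛ) ^ j ⊛ X ^ b j
        ≈⟨ solve 3 (λ s x y → s :* x :+ :- con ℤ.1ℤ :* s :* y := s :* (x :+ :- y)) ≋-refl ((⊝ 1ₛ) ^ j) (X ^ a j) (X ^ b j) ⟩
      (⊝ 1ₛ) ^ j ⊛ (X ^ a j ⊕ ⊝ X ^ b j) ∎
      where open ≋-Reasoning

  pochhammers-≈[]Θ : ∀ {n N} → n + n < N → pochhammer z N ⊛ pochhammer w N ⊛ pochhammer Q N ≈[ n ] Θ n
  pochhammers-≈[]Θ {n} n+n<N = ≈[]-trans (truncatedTripleProduct n+n<N) (≋⇒≈[] (∑-cong n tripleProductTerm))

  block : ℕ → Series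
  block i = (1ₛ ⊕ ⊝ X ^ (12 + i * 108)) ⊛ (1ₛ ⊕ ⊝ X ^ (96 + i * 108)) ⊛ (1ₛ ⊕ ⊝ X ^ (108 + i * 108))

  pochhammers-∏block : ∀ N → pochhammer z N ⊛ pochhammer w N ⊛ pochhammer Q N ≋ ∏[ i < N ] block i
  pochhammers-∏block N = begin
    pochhammer z N ⊛ pochhammer w N ⊛ pochhammer Q N
      ≈⟨ ≋-sym (≋-trans (∏-⊛ N _ _) (*-congʳ (∏-⊛ N _ _))) ⟩
    ∏[ i < N ] (factor 96 i ⊛ factor 12 i ⊛ factor 108 i)
      ≈⟨ ∏-cong N (λ i → solve 3 (λ x y z → x :* y :* z := y :* x :* z) ≋-refl (factor 96 i) (factor 12 i) (factor 108 i)) ⟩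
    ∏[ i < N ] (factor 12 i ⊛ factor 96 i ⊛ factor 108 i)
      ≈⟨ ∏-cong N (λ i → ⊛-cong (⊛-cong (factor-≋ 12 i) (factor-≋ 96 i)) (factor-≋ 108 i)) ⟩
    ∏[ i < N ] block i ∎
    where
    open ≋-Reasoning
    factor : ℕ → ℕ → Series
    factor r i = 1ₛ ⊕ ⊝ (X ^ r ⊛ Q ^ i)
    factor-≋ : ∀ r i → factor r i ≋ 1ₛ ⊕ ⊝ X ^ (r + i * 108)
    factor-≋ r i = +-congˡ (-‿cong (begin
      X ^ r ⊛ (X ^ 108) ^ i   ≈⟨ *-congˡ (^-assocʳ X 108 i) ⟩
      X ^ r ⊛ X ^ (108 * i)   ≈⟨ ^-homo-* X r (108 * i) ⟨
      X ^ (r + 108 * i)       ≡⟨ cong (λ e → X ^ (r + e)) (ℕ.*-comm 108 i) ⟩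
      X ^ (r + i * 108)       ∎))

  -- The gaps between consecutive exponents 12, 96, 108, 120, … of ∏[ i < N ] block i.
  blockGaps : ℕ → List ℕ
  blockGaps zero    = []
  blockGaps (suc N) = 11 ∷ 83 ∷ 11 ∷ blockGaps N

  span-blockGaps : ∀ N → span (blockGaps N) ≡ N * 108
  span-blockGaps zero    = refl
  span-blockGaps (suc N) = cong (108 +_) (span-blockGaps N)

  removedFactors-blockGaps : ∀ t N → removedFactors (t * 108) (blockGaps N) ≋ ∏[ i < N ] block (t + i)
  removedFactors-blockGaps t zero    = ≋-refl
  removedFactors-blockGaps t (suc N) = begin
    A ⊛ (B ⊛ (C ⊛ removedFactors (suc t * 108) (blockGaps N)))
      ≈⟨ *-congˡ (*-congˡ (*-congˡ (removedFactors-blockGaps (suc t) N))) ⟩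
    A ⊛ (B ⊛ (C ⊛ ∏[ i < N ] block (suc t + i)))
      ≈⟨ solve 4 (λ A B C P → A :* (B :* (C :* P)) := A :* B :* C :* P) ≋-refl A B C (∏[ i < N ] block (suc t + i)) ⟩
    block t ⊛ ∏[ i < N ] block (suc t + i)
      ≈⟨ ⊛-cong (≡⇒≋ (cong block (sym (ℕ.+-identityʳ t)))) (∏-cong N λ i → ≡⇒≋ (cong block (sym (ℕ.+-suc t i)))) ⟩
    block (t + 0) ⊛ ∏[ i < N ] block (t + suc i)
      ≈⟨ ∏-suc N (λ i → block (t + i)) ⟨
    ∏[ i < suc N ] block (t + i) ∎
    where
    open ≋-Reasoning
    A = 1ₛ ⊕ ⊝ X ^ (12 + t * 108)
    B = 1ₛ ⊕ ⊝ X ^ (96 + t * 108)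
    C = 1ₛ ⊕ ⊝ X ^ (108 + t * 108)

  ovUpTo-⊛-∏block-nonNegative : ∀ N → NonNegative (ofℕ (ovUpTo (N * 108)) ⊛ ∏[ i < N ] block i)
  ovUpTo-⊛-∏block-nonNegative N =
    nonNegative-≋ (⊛-cong (≋-trans (≡⇒≋ (cong (partFactors 0) (span-blockGaps N))) (≋-sym (ofℕ-ovUpTo (N * 108))))
                          (removedFactors-blockGaps 0 N))
                  (partFactors-⊛-removedFactors-nonNegative 0 (blockGaps N))

  private
    ⊝1^-≋-sign : ∀ j → (⊝ 1ₛ) ^ j ≋ const (sign j)
    ⊝1^-≋-sign zero          = ≋-refl
    ⊝1^-≋-sign (suc zero)    = ≋-trans (⊛-identityʳ (⊝ 1ₛ)) (coeffwise λ { zero → refl ; (suc _) → refl })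
    ⊝1^-≋-sign (suc (suc j)) =
      ≋-trans (solve 1 (λ s → :- con ℤ.1ℤ :* (:- con ℤ.1ℤ :* s) := s) ≋-refl ((⊝ 1ₛ) ^ j)) (⊝1^-≋-sign j)

    coeff-⊛-sign : ∀ f j g m → coeff (f ⊛ ((⊝ 1ₛ) ^ j ⊛ g)) m ≡ sign j ℤ.* coeff (f ⊛ g) m
    coeff-⊛-sign f j g m = trans (coeff-≡ regroup m) (const-⊛ (sign j) (f ⊛ g) m)
      where
      regroup : f ⊛ ((⊝ 1ₛ) ^ j ⊛ g) ≋ const (sign j) ⊛ (f ⊛ g)
      regroup = ≋-trans (solve 3 (λ f s g → f :* (s :* g) := s :* (f :* g)) ≋-refl f ((⊝ 1ₛ) ^ j) g) (*-congʳ (⊝1^-≋-sign j))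

    coeff-⊛-∑ : ∀ f n g m → coeff (f ⊛ ∑ n g) m ≡ sumTo n (λ j → coeff (f ⊛ g j) m)
    coeff-⊛-∑ f zero    g m = refl
    coeff-⊛-∑ f (suc n) g m =
      trans (coeff-≡ (⊛-distribˡ f (∑ n g) (g (suc n))) m) (cong (ℤ._+ coeff (f ⊛ g (suc n)) m) (coeff-⊛-∑ f n g m))

    -- p̄ vanishes at negative arguments, matching the zero coefficients of X^e below degree e.
    coeff-ovUpTo-⊛-X^ : ∀ {n K} e → n ≤ K → coeff (ofℕ (ovUpTo K) ⊛ X ^ e) n ≡ pbarℤ (ℤ.+ n ℤ.- ℤ.+ e)
    coeff-ovUpTo-⊛-X^ {n} {K} e n≤K = trans (coeff-≡ (≋-trans (⊛-comm O (X ^ e)) (X^-⊛ e O)) n) (shifted (e ≤? n))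
      where
      O = ofℕ (ovUpTo K)
      shifted : Dec (e ≤ n) → coeff (shiftBy e O) n ≡ pbarℤ (ℤ.+ n ℤ.- ℤ.+ e)
      shifted (yes e≤n) = subst (λ m → m ≤ K → coeff (shiftBy e O) m ≡ pbarℤ (ℤ.+ m ℤ.- ℤ.+ e))
                                (ℕ.m+[n∸m]≡n e≤n) (beyond (n ∸ e)) n≤K
        where
        cancel : ∀ x y → x ℤ.+ y ℤ.- x ≡ y
        cancel = ℤ-solve-∀
        beyond : ∀ r → e + r ≤ K → coeff (shiftBy e O) (e + r) ≡ pbarℤ (ℤ.+ (e + r) ℤ.- ℤ.+ e)
        beyond r e+r≤K = begin
          coeff (shiftBy e O) (e + r)        ≡⟨ shiftBy-+ e r O ⟩
          ℤ.+ ovUpTo K r                     ≡⟨ cong ℤ.+_ (ovUpTo-stable (ℕ.≤-trans (ℕ.m≤n+m r e) e+r≤K)) ⟩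
          pbarℤ (ℤ.+ r)                      ≡⟨ cong pbarℤ (cancel (ℤ.+ e) (ℤ.+ r)) ⟨
          pbarℤ (ℤ.+ e ℤ.+ ℤ.+ r ℤ.- ℤ.+ e)  ≡⟨ cong (λ t → pbarℤ (t ℤ.- ℤ.+ e)) (ℤ.pos-+ e r) ⟨
          pbarℤ (ℤ.+ (e + r) ℤ.- ℤ.+ e)      ∎
          where open ≡-Reasoning
      shifted (no e≰n) = trans (shiftBy-< O (ℕ.≰⇒> e≰n))
                               (sym (negative (e ∸ suc n) (trans (ℕ.+-suc n _) (ℕ.m+[n∸m]≡n (ℕ.≰⇒> e≰n)))))
        where
        cancel : ∀ x y → x ℤ.- (x ℤ.+ y) ≡ ℤ.- y
        cancel = ℤ-solve-∀
        negative : ∀ d → n + suc d ≡ e → pbarℤ (ℤ.+ n ℤ.- ℤ.+ e) ≡ ℤ.0ℤ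
        negative d refl = cong pbarℤ (trans (cong (ℤ._-_ (ℤ.+ n)) (ℤ.pos-+ n (suc d))) (cancel (ℤ.+ n) (ℤ.+ suc d)))

    a-cast : ∀ j → ℤ.+ a j ≡ ℤ.+ 6 ℤ.* ℤ.+ j ℤ.* (ℤ.+ 9 ℤ.* ℤ.+ j ℤ.+ ℤ.+ 7)
    a-cast j = begin
      ℤ.+ (6 * j * (9 * j + 7))                             ≡⟨ ℤ.pos-* (6 * j) (9 * j + 7) ⟩
      ℤ.+ (6 * j) ℤ.* ℤ.+ (9 * j + 7)                       ≡⟨ cong₂ ℤ._*_ (ℤ.pos-* 6 j) (ℤ.pos-+ (9 * j) 7) ⟩
      ℤ.+ 6 ℤ.* ℤ.+ j ℤ.* (ℤ.+ (9 * j) ℤ.+ ℤ.+ 7)           ≡⟨ cong (λ t → ℤ.+ 6 ℤ.* ℤ.+ j ℤ.* (t ℤ.+ ℤ.+ 7)) (ℤ.pos-* 9 j) ⟩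
      ℤ.+ 6 ℤ.* ℤ.+ j ℤ.* (ℤ.+ 9 ℤ.* ℤ.+ j ℤ.+ ℤ.+ 7)       ∎
      where open ≡-Reasoning

    b-cast : ∀ n j → ℤ.+ n ℤ.- ℤ.+ b j ≡ ℤ.+ n ℤ.- ℤ.+ 6 ℤ.* ℤ.+ j ℤ.* (ℤ.+ 9 ℤ.* ℤ.+ j ℤ.+ ℤ.+ 11) ℤ.- ℤ.+ 12
    b-cast n j = begin
      ℤ.+ n ℤ.- ℤ.+ (6 * j * (9 * j + 11) + 12)                     ≡⟨ cong (ℤ._-_ (ℤ.+ n)) (ℤ.pos-+ (6 * j * (9 * j + 11)) 12) ⟩
      ℤ.+ n ℤ.- (ℤ.+ (6 * j * (9 * j + 11)) ℤ.+ ℤ.+ 12)             ≡⟨ cong (λ t → ℤ.+ n ℤ.- (t ℤ.+ ℤ.+ 12)) product ⟩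
      ℤ.+ n ℤ.- (ℤ.+ 6 ℤ.* ℤ.+ j ℤ.* (ℤ.+ 9 ℤ.* ℤ.+ j ℤ.+ ℤ.+ 11) ℤ.+ ℤ.+ 12)
                                                                     ≡⟨ subtract (ℤ.+ n) (ℤ.+ 6 ℤ.* ℤ.+ j ℤ.* (ℤ.+ 9 ℤ.* ℤ.+ j ℤ.+ ℤ.+ 11)) (ℤ.+ 12) ⟩
      ℤ.+ n ℤ.- ℤ.+ 6 ℤ.* ℤ.+ j ℤ.* (ℤ.+ 9 ℤ.* ℤ.+ j ℤ.+ ℤ.+ 11) ℤ.- ℤ.+ 12 ∎
      where
      open ≡-Reasoning
      product : ℤ.+ (6 * j * (9 * j + 11)) ≡ ℤ.+ 6 ℤ.* ℤ.+ j ℤ.* (ℤ.+ 9 ℤ.* ℤ.+ j ℤ.+ ℤ.+ 11)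
      product = trans (ℤ.pos-* (6 * j) (9 * j + 11))
        (cong₂ ℤ._*_ (ℤ.pos-* 6 j) (trans (ℤ.pos-+ (9 * j) 11) (cong (ℤ._+ ℤ.+ 11) (ℤ.pos-* 9 j))))
      subtract : ∀ x y z → x ℤ.- (y ℤ.+ z) ≡ x ℤ.- y ℤ.- z
      subtract = ℤ-solve-∀

  coeff-ovUpTo-⊛-Θ : ∀ {n K} → n ≤ K → coeff (ofℕ (ovUpTo K) ⊛ Θ n) n ≡
    sumTo n (λ j → sign j ℤ.*
      (pbarℤ (ℤ.+ n ℤ.- ℤ.+ 6 ℤ.* ℤ.+ j ℤ.* (ℤ.+ 9 ℤ.* ℤ.+ j ℤ.+ ℤ.+ 7))
       ℤ.- pbarℤ (ℤ.+ n ℤ.- ℤ.+ 6 ℤ.* ℤ.+ j ℤ.* (ℤ.+ 9 ℤ.* ℤ.+ j ℤ.+ ℤ.+ 11) ℤ.- ℤ.+ 12)))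
  coeff-ovUpTo-⊛-Θ {n} {K} n≤K = trans (coeff-⊛-∑ O n (λ j → (⊝ 1ₛ) ^ j ⊛ (X ^ a j ⊕ ⊝ X ^ b j)) n) (sumTo-cong n term)
    where
    O = ofℕ (ovUpTo K)
    sumTo-cong : ∀ M {f g : ℕ → ℤ.ℤ} → (∀ j → f j ≡ g j) → sumTo M f ≡ sumTo M g
    sumTo-cong zero    f≡g = f≡g 0
    sumTo-cong (suc M) f≡g = cong₂ ℤ._+_ (sumTo-cong M f≡g) (f≡g (suc M))
    term : ∀ j → coeff (O ⊛ ((⊝ 1ₛ) ^ j ⊛ (X ^ a j ⊕ ⊝ X ^ b j))) n ≡
      sign j ℤ.* (pbarℤ (ℤ.+ n ℤ.- ℤ.+ 6 ℤ.* ℤ.+ j ℤ.* (ℤ.+ 9 ℤ.* ℤ.+ j ℤ.+ ℤ.+ 7))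
                  ℤ.- pbarℤ (ℤ.+ n ℤ.- ℤ.+ 6 ℤ.* ℤ.+ j ℤ.* (ℤ.+ 9 ℤ.* ℤ.+ j ℤ.+ ℤ.+ 11) ℤ.- ℤ.+ 12))
    term j = begin
      coeff (O ⊛ ((⊝ 1ₛ) ^ j ⊛ (X ^ a j ⊕ ⊝ X ^ b j))) n
        ≡⟨ coeff-⊛-sign O j (X ^ a j ⊕ ⊝ X ^ b j) n ⟩
      sign j ℤ.* coeff (O ⊛ (X ^ a j ⊕ ⊝ X ^ b j)) n
        ≡⟨ cong (sign j ℤ.*_) (coeff-≡ (≋-trans (⊛-distribˡ O (X ^ a j) (⊝ X ^ b j))
                                                (+-congˡ (solve 2 (λ o x → o :* :- x := :- (o :* x)) ≋-refl O (X ^ b j)))) n) ⟩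
      sign j ℤ.* (coeff (O ⊛ X ^ a j) n ℤ.- coeff (O ⊛ X ^ b j) n)
        ≡⟨ cong (sign j ℤ.*_) (cong₂ ℤ._-_ (coeff-ovUpTo-⊛-X^ (a j) n≤K) (coeff-ovUpTo-⊛-X^ (b j) n≤K)) ⟩
      sign j ℤ.* (pbarℤ (ℤ.+ n ℤ.- ℤ.+ a j) ℤ.- pbarℤ (ℤ.+ n ℤ.- ℤ.+ b j))
        ≡⟨ cong (sign j ℤ.*_) (cong₂ ℤ._-_ (cong (λ t → pbarℤ (ℤ.+ n ℤ.- t)) (a-cast j)) (cong pbarℤ (b-cast n j))) ⟩
      sign j ℤ.* (pbarℤ (ℤ.+ n ℤ.- ℤ.+ 6 ℤ.* ℤ.+ j ℤ.* (ℤ.+ 9 ℤ.* ℤ.+ j ℤ.+ ℤ.+ 7))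
                  ℤ.- pbarℤ (ℤ.+ n ℤ.- ℤ.+ 6 ℤ.* ℤ.+ j ℤ.* (ℤ.+ 9 ℤ.* ℤ.+ j ℤ.+ ℤ.+ 11) ℤ.- ℤ.+ 12)) ∎
      where open ≡-Reasoning

open import Defs
open import Data.Integer using (+_; _+_; _-_; _*_; _≤_)
import Data.Nat as ℕ
import Data.Nat.Properties as ℕ
open import Relation.Binary.PropositionalEquality using (subst; trans)
open PowerSeries using (_⊛_; ≋-sym; coeff-≥0)
open BigOperators using (∏)
open Truncation using (_≈[_]_; coeff-≡-≤; ⊛-≈[]; ≈[]-refl; ≈[]-trans; ≋⇒≈[])
open Overpartitions using (ofℕ)
open Modulus108

corollary4 : (n : ℕ) →
    + 0 ≤ sumTo n (λ j → sign j *
    (pbarℤ (+ n - + 6 * + j * (+ 9 * + j + + 7))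
    - pbarℤ (+ n - + 6 * + j * (+ 9 * + j + + 11) - + 12)))
corollary4 n = subst (+ 0 ≤_) (trans (coeff-≡-≤ agreement (ℕ.≤-refl {n})) (coeff-ovUpTo-⊛-Θ n≤K))
                     (coeff-≥0 (ovUpTo-⊛-∏block-nonNegative N) n)
  where
  N = ℕ.suc (n ℕ.+ n)
  agreement : ofℕ (ovUpTo (N ℕ.* 108)) ⊛ ∏ N block ≈[ n ] ofℕ (ovUpTo (N ℕ.* 108)) ⊛ Θ n
  agreement = ⊛-≈[] ≈[]-refl (≈[]-trans (≋⇒≈[] (≋-sym (pochhammers-∏block N))) (pochhammers-≈[]Θ (ℕ.n<1+n (n ℕ.+ n))))
  n≤K : n ℕ.≤ N ℕ.* 108
  n≤K = ℕ.≤-trans (ℕ.m≤m+n n n) (ℕ.≤-trans (ℕ.n≤1+n (n ℕ.+ n)) (ℕ.m≤m*n N 108))
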